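{- Let $m\ge 1$, $n=2m$, let $\mathbb{V}_n$ be an $n$-dimensional vector space over $\mathbb{F}_2$ with a fixed nondegenerate inner product $u\cdot v$, let $1\le k\le m$, and let $B$ be an abelian group of order $2^k$ (written additively, with identity $0$). (I) Let $\mathcal{S}$ be a partial spread of $\mathbb{V}_n$ consisting of $(2^k-1)2^{m-k}$ subspaces, and distribute these subspaces so that each nonzero $\gamma\in B$ is assigned exactly $2^{m-k}$ of them, say $U_{\gamma,1},\dots,U_{\gamma,2^{m-k}}$, every subspace of $\mathcal{S}$ being assigned to exactly one $\gamma$. Define $f:\mathbb{V}_n\to B$ by $f^{ -1}(\gamma)=\bigcup_{i=1}^{2^{m-k}}(U_{\gamma,i}\setminus\{0\})$ for each nonzero $\gamma\in B$, and $f(x)=0$ for all remaining $x$ (i.e. for $x\in\mathbb{V}_n\setminus\bigcup_{U\in\mathcal{S}}(U\setminus\{0\})$). Then $f$ is bent. (II) Let $\mathcal{S}$ be a partial spread of $\mathbb{V}_n$ with $2^m-2^{m-k}+1$ subspaces, fix a nonzero $\tilde\gamma\in B$, and distribute the subspaces so that $\tilde\gamma$ is assigned $2^{m-k}+1$ of them, $U_{\tilde\gamma,1},\dots,U_{\tilde\gamma,2^{m-k}+1}$, and each nonzero $\gamma\ne\tilde\gamma$ is assigned $2^{m-k}$ of them, each subspace being assigned exactly once. Define $g:\mathbb{V}_n\to B$ by $g^{ -1}(\tilde\gamma)=\bigcup_{i=1}^{2^{m-k}+1}U_{\tilde\gamma,i}$ (so $g(0)=\tilde\gamma$), $g^{ -1}(\gamma)=\bigcup_{i=1}^{2^{m-k}}(U_{\gamma,i}\setminus\{0\})$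 for nonzero $\gamma\neq\tilde\gamma$, and $g(x)=0$ for all remaining $x$. Then $g$ is bent.
   Context: A partial spread of $\mathbb{V}_{2m}$ is a set of $m$-dimensional subspaces of $\mathbb{V}_{2m}$ which pairwise intersect only in $\{0\}$. A function $h:\mathbb{V}_n\to B$ is called bent if for every nontrivial character $\chi$ of $B$ and every $b\in\mathbb{V}_n$ we have $\left|\sum_{x\in\mathbb{V}_n}\chi(h(x))(-1)^{b\cdot x}\right|=2^{m}$. -}

module Defs where

open import Data.Nat as ℕ using (ℕ; zero; suc; _^_; _∸_; _<_; _%_)
open import Data.Nat.Properties using (m^n≢0)
open import Data.Integer as ℤ using (ℤ; +_; -[1+_])
open import Data.Bool using (Bool; true; false; if_then_else_; _xor_)
open import Data.Fin using (Fin; toℕ)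
import Data.Fin as Fin
open import Data.Vec using (Vec; []; _∷_; replicate; zipWith)
open import Data.Product using (Σ; ∃; _×_; _,_)
open import Relation.Binary.PropositionalEquality using (_≡_; _≢_)
open import Relation.Nullary using (¬_; does)
open import Algebra.Structures using (IsAbelianGroup)

V : ℕ → Set
V n = Vec Bool n

zeroV : ∀ {n} → V n
zeroV = replicate _ false

_+V_ : ∀ {n} → V n → V n → V n
_+V_ = zipWith _xor_

record InnerProduct (n : ℕ) : Set where
  field
    _·_        : V n → V n → Bool
    symmetric  : ∀ x y → x · y ≡ y · x
    linearˡ    : ∀ x y z → (x +V y) · z ≡ (x · z) xor (y · z)
    linearʳ    : ∀ x y z → x · (y +V z) ≡ (x · y) xor (x · z)
    nondegen   : ∀ x → (∀ y → x · y ≡ false) → x ≡ zeroV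

-- m-dimensional subspaces of V_n, given by a basis of m linearly
-- independent vectors; the subspace is their F_2-span.

comb : ∀ {n m} → Vec (V n) m → Vec Bool m → V n
comb []       []       = zeroV
comb (b ∷ bs) (c ∷ cs) = if c then b +V comb bs cs else comb bs cs

record Subspace (n m : ℕ) : Set where
  field
    basis       : Vec (V n) m
    independent : ∀ c → comb basis c ≡ zeroV → c ≡ replicate m false

_∈S_ : ∀ {n m} → V n → Subspace n m → Set
x ∈S U = ∃ λ c → comb (Subspace.basis U) c ≡ x

TrivInt : ∀ {n m} → Subspace n m → Subspace n m → Set
TrivInt U W = ∀ x → x ∈S U → x ∈S W → x ≡ zeroV

record AbGroupOfOrder2^ (k : ℕ) : Set where
  field
    _⊕_   : Fin (2 ^ k) → Fin (2 ^ k) → Fin (2 ^ k)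
    𝟘     : Fin (2 ^ k)
    ⊖_    : Fin (2 ^ k) → Fin (2 ^ k)
    isAbelianGroup : IsAbelianGroup _≡_ _⊕_ 𝟘 ⊖_

-- Complex characters of a group B of order 2^k take values in the
-- 2^k-th roots of unity; we write χ(b) = ζ^(c(b)) with ζ = exp(2πi/2^k),
-- c : B → ℤ/2^kℤ (represented by ℕ, read modulo 2^k).

mod2^ : (k : ℕ) → ℕ → ℕ
mod2^ k e = _%_ e (2 ^ k) {{m^n≢0 2 k}}

record Character {k : ℕ} (B : AbGroupOfOrder2^ k) : Set where
  open AbGroupOfOrder2^ B
  field
    exponent : Fin (2 ^ k) → ℕ
    homo     : ∀ a b → mod2^ k (exponent (a ⊕ b)) ≡ mod2^ k (exponent a ℕ.+ exponent b)

Nontrivial : ∀ {k} {B : AbGroupOfOrder2^ k} → Character B → Set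
Nontrivial {k} χ = ∃ λ a → mod2^ k (Character.exponent χ a) ≢ 0

-- The cyclotomic ring ℤ[ζ], ζ a primitive 2^k-th root of unity (k ≥ 1),
-- with ℤ-basis 1, ζ, …, ζ^(H-1), H = 2^(k-1), and ζ^H = -1.
-- An element is its coefficient vector.

half : ℕ → ℕ
half k = 2 ^ (k ∸ 1)

record Cyc (k : ℕ) : Set where
  constructor cyc
  field coeff : Fin (half k) → ℤ
open Cyc public

0C : ∀ {k} → Cyc k
0C = cyc λ _ → + 0

_⊞_ : ∀ {k} → Cyc k → Cyc k → Cyc k
a ⊞ b = cyc λ j → coeff a j ℤ.+ coeff b j

scale : ∀ {k} → ℤ → Cyc k → Cyc k
scale z a = cyc λ j → z ℤ.* coeff a j

ζ^ : (k : ℕ) → ℕ → Cyc k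
ζ^ k e = cyc λ j →
  let r = mod2^ k e in
  if does (toℕ j ℕ.≟ r) then + 1
  else if does ((toℕ j ℕ.+ half k) ℕ.≟ r) then -[1+ 0 ]
  else + 0

sumFin : ∀ {k} n → (Fin n → Cyc k) → Cyc k
sumFin zero    f = 0C
sumFin (suc n) f = f Fin.zero ⊞ sumFin n (λ i → f (Fin.suc i))

_⊠_ : ∀ {k} → Cyc k → Cyc k → Cyc k
_⊠_ {k} a b = sumFin (half k) λ i → sumFin (half k) λ j →
  scale (coeff a i ℤ.* coeff b j) (ζ^ k (toℕ i ℕ.+ toℕ j))

conj : ∀ {k} → Cyc k → Cyc k
conj {k} a = sumFin (half k) λ i → scale (coeff a i) (ζ^ k (2 ^ k ∸ toℕ i))

constC : ∀ {k} → ℤ → Cyc k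
constC {k} z = scale z (ζ^ k 0)

_≋_ : ∀ {k} → Cyc k → Cyc k → Set
a ≋ b = ∀ j → coeff a j ≡ coeff b j

sumV : ∀ {k} n → (V n → Cyc k) → Cyc k
sumV zero    f = f []
sumV (suc n) f = sumV n (λ v → f (false ∷ v)) ⊞ sumV n (λ v → f (true ∷ v))

-- Bentness (n = 2m): for every nontrivial character χ of B and every b,
-- |Σ_x χ(h x) (-1)^(b·x)| = 2^m, i.e. S · conj(S) = 2^(2m).
-- (-1) = ζ^H, so (-1)^(b·x) = ζ^(H·[b·x]).

bitExp : ℕ → Bool → ℕ
bitExp k true  = half k
bitExp k false = 0

walshSum : ∀ {k m} (B : AbGroupOfOrder2^ k) (ip : InnerProduct (2 ℕ.* m)) →
           (V (2 ℕ.* m) → Fin (2 ^ k)) → Character B → V (2 ℕ.* m) → Cyc k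
walshSum {k} {m} B ip h χ b =
  sumV (2 ℕ.* m) λ x →
    ζ^ k (Character.exponent χ (h x) ℕ.+ bitExp k (InnerProduct._·_ ip b x))

IsBent : ∀ {k m} (B : AbGroupOfOrder2^ k) (ip : InnerProduct (2 ℕ.* m)) →
         (V (2 ℕ.* m) → Fin (2 ^ k)) → Set
IsBent {k} {m} B ip h =
  ∀ (χ : Character B) → Nontrivial χ → ∀ b →
    let S = walshSum {k} {m} B ip h χ b in
    (S ⊠ conj S) ≋ constC (+ (2 ^ (2 ℕ.* m)))

-- Write ε γ = ζ^χ(γ) - 1 for a nontrivial character χ of B, so that ε 𝟘 = 0. Pointwise
--   ζ^χ(h x) = 1 + Σ_(γ,i) ([x ∈ U γ i] - [x = 0]) ε γ + [x = 0] ε γ₀,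
-- the sum running over the spread members in use. The Walsh transform at b of the indicator of an
-- m-dimensional subspace U is 2^m or 0 according as b ⊥ U or not, and two members of a partial
-- spread of V_2m span V_2m, so a nonzero b is orthogonal to at most one member. Since
-- Σ_γ ε γ = -2^k and every nonzero γ labels 2^(m-k) members (γ̃ one more in (II)), the terms
-- collapse: the Walsh sum at b is 2^m ζ^χ(γ) for a single γ, whose norm is 2^(2m).

module Submission where

open import Defs
open import Algebra.Bundles using (CommutativeMonoid; AbelianGroup)
open import Algebra.Structures using (IsAbelianGroup)
import Algebra.Properties.CommutativeSemigroup as CommutativeSemigroupProperties
import Algebra.Properties.CommutativeMonoid.Sum as CommutativeMonoidSum
import Algebra.Properties.Group as GroupProperties
import Relation.Binary.Reasoning.Setoid as SetoidReasoning
open import Data.Bool using (Bool; true; false; if_then_else_; _xor_; not; _∧_)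
import Data.Bool.Properties as 𝔹
open import Data.Empty using (⊥-elim)
open import Data.Fin using (Fin; toℕ; fromℕ<) renaming (zero to fzero; suc to fsuc)
import Data.Fin as Fin
import Data.Fin.Properties as Finₚ
import Data.Fin.Permutation as Perm
open import Data.Integer as ℤ using (ℤ; +_; -[1+_]; -1ℤ)
import Data.Integer.Properties as ℤₚ
open import Data.Integer.Tactic.RingSolver using (solve-∀)
open import Data.Nat as ℕ using (ℕ; zero; suc; _^_; _∸_; _*_; _≤_; _<_; _%_)
import Data.Nat.Properties as ℕₚ
import Data.Nat.DivMod as ℕ÷
open import Data.Product using (∃; _×_; _,_; proj₁; proj₂)
open import Data.Sum using (_⊎_; inj₁; inj₂)
open import Data.Vec using (Vec; []; _∷_; _++_; splitAt)
import Data.Vec as Vec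
import Data.Vec.Properties as Vecₚ
open import Function using (_∘_; id)
open import Function.Definitions using (Injective)
open import Level using (0ℓ)
open import Relation.Binary.PropositionalEquality as ≡
  using (_≡_; _≢_)
open import Relation.Nullary using (¬_; Dec; yes; no; does; ¬?)
open import Relation.Nullary.Decidable using (dec-true; dec-false; _×-dec_; _⊎-dec_; map′)

module FiniteSums {c ℓ} (M : CommutativeMonoid c ℓ) where
  open CommutativeMonoid M
  open CommutativeSemigroupProperties commutativeSemigroup using (interchange)
  open CommutativeMonoidSum M public using (sum; ∑-distrib-+; sum-cong-≋; ∑-permute)
  open CommutativeMonoidSum M using (sum-replicate-zero)

  ∑V : ∀ n → (V n → Carrier) → Carrier
  ∑V zero    f = f []
  ∑V (suc n) f = ∑V n (f ∘ (false ∷_)) ∙ ∑V n (f ∘ (true ∷_))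

  ∑V-cong : ∀ n {f g : V n → Carrier} → (∀ x → f x ≈ g x) → ∑V n f ≈ ∑V n g
  ∑V-cong zero    f≈g = f≈g []
  ∑V-cong (suc n) f≈g = ∙-cong (∑V-cong n (f≈g ∘ (false ∷_))) (∑V-cong n (f≈g ∘ (true ∷_)))

  ∑V-distrib : ∀ n (f g : V n → Carrier) → ∑V n (λ x → f x ∙ g x) ≈ ∑V n f ∙ ∑V n g
  ∑V-distrib zero    f g = refl
  ∑V-distrib (suc n) f g = trans (∙-cong (∑V-distrib n _ _) (∑V-distrib n _ _)) (interchange _ _ _ _)

  ∑V-zero : ∀ n {f : V n → Carrier} → (∀ x → f x ≈ ε) → ∑V n f ≈ ε
  ∑V-zero zero    f≈ε = f≈ε []
  ∑V-zero (suc n) f≈ε =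
    trans (∙-cong (∑V-zero n (f≈ε ∘ (false ∷_))) (∑V-zero n (f≈ε ∘ (true ∷_)))) (identityˡ ε)

  ∑V-comm : ∀ n l (F : V n → V l → Carrier) →
            ∑V n (λ x → ∑V l (F x)) ≈ ∑V l (λ y → ∑V n (λ x → F x y))
  ∑V-comm n zero    F = refl
  ∑V-comm n (suc l) F = trans (∑V-distrib n _ _) (∙-cong (∑V-comm n l _) (∑V-comm n l _))

  ∑-zero : ∀ {p} {f : Fin p → Carrier} → (∀ i → f i ≈ ε) → sum f ≈ ε
  ∑-zero {p} f≈ε = trans (sum-cong-≋ f≈ε) (sum-replicate-zero p)

  ∑V-∑-comm : ∀ n p (F : V n → Fin p → Carrier) →
              ∑V n (λ x → sum (F x)) ≈ sum (λ i → ∑V n (λ x → F x i))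
  ∑V-∑-comm n zero    F = ∑V-zero n (λ _ → refl)
  ∑V-∑-comm n (suc p) F = trans (∑V-distrib n _ _) (∙-cong refl (∑V-∑-comm n p (λ x → F x ∘ fsuc)))

  ∑V-single : ∀ n (v : V n) {f : V n → Carrier} → (∀ x → x ≢ v → f x ≈ ε) → ∑V n f ≈ f v
  ∑V-single zero    []          f≈ε = refl
  ∑V-single (suc n) (false ∷ v) f≈ε = trans
    (∙-cong (∑V-single n v (λ x x≢v → f≈ε (false ∷ x) (x≢v ∘ Vecₚ.∷-injectiveʳ)))
            (∑V-zero n (λ x → f≈ε (true ∷ x) (λ ()))))
    (identityʳ _)
  ∑V-single (suc n) (true ∷ v)  f≈ε = trans
    (∙-cong (∑V-zero n (λ x → f≈ε (false ∷ x) (λ ())))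
            (∑V-single n v (λ x x≢v → f≈ε (true ∷ x) (x≢v ∘ Vecₚ.∷-injectiveʳ))))
    (identityˡ _)

  ∑-single : ∀ {p} (i : Fin p) {f : Fin p → Carrier} → (∀ j → j ≢ i → f j ≈ ε) → sum f ≈ f i
  ∑-single {suc p} fzero    f≈ε = trans (∙-cong refl (∑-zero (λ j → f≈ε (fsuc j) (λ ())))) (identityʳ _)
  ∑-single {suc p} (fsuc i) f≈ε =
    trans (∙-cong (f≈ε fzero (λ ())) (∑-single i (λ j j≢i → f≈ε (fsuc j) (j≢i ∘ Finₚ.suc-injective))))
          (identityˡ _)

  ∑∑-zero : ∀ {p q} {F : Fin p → Fin q → Carrier} → (∀ i j → F i j ≈ ε) → sum (λ i → sum (F i)) ≈ ε
  ∑∑-zero F≈ε = ∑-zero (λ i → ∑-zero (F≈ε i))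

  ∑∑-single : ∀ {p q} (i : Fin p) (j : Fin q) {F : Fin p → Fin q → Carrier} →
              (∀ i′ j′ → (i′ , j′) ≢ (i , j) → F i′ j′ ≈ ε) → sum (λ i′ → sum (F i′)) ≈ F i j
  ∑∑-single i j F≈ε = trans
    (∑-single i (λ i′ i′≢i → ∑-zero (λ j′ → F≈ε i′ j′ (i′≢i ∘ ≡.cong proj₁))))
    (∑-single j (λ j′ j′≢j → F≈ε i j′ (λ { ≡.refl → j′≢j ≡.refl })))

  ∑∑-distrib : ∀ {p q} (F G : Fin p → Fin q → Carrier) →
               sum (λ i → sum (λ j → F i j ∙ G i j)) ≈ sum (λ i → sum (F i)) ∙ sum (λ i → sum (G i))
  ∑∑-distrib {p} F G = trans (sum-cong-≋ (λ i → ∑-distrib-+ (F i) (G i))) (∑-distrib-+ {p} _ _)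

module SumHomomorphism {c₁ ℓ₁ c₂ ℓ₂} (M₁ : CommutativeMonoid c₁ ℓ₁) (M₂ : CommutativeMonoid c₂ ℓ₂)
  (φ : CommutativeMonoid.Carrier M₁ → CommutativeMonoid.Carrier M₂)
  (φ-∙ : ∀ a b → CommutativeMonoid._≈_ M₂ (φ (CommutativeMonoid._∙_ M₁ a b))
                                         (CommutativeMonoid._∙_ M₂ (φ a) (φ b)))
  (φ-ε : CommutativeMonoid._≈_ M₂ (φ (CommutativeMonoid.ε M₁)) (CommutativeMonoid.ε M₂)) where
  private
    module Σ₁ = FiniteSums M₁
    module Σ₂ = FiniteSums M₂
  open CommutativeMonoid M₂

  ∑V-hom : ∀ n f → φ (Σ₁.∑V n f) ≈ Σ₂.∑V n (φ ∘ f)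
  ∑V-hom zero    f = refl
  ∑V-hom (suc n) f = trans (φ-∙ _ _) (∙-cong (∑V-hom n _) (∑V-hom n _))

  ∑-hom : ∀ p f → φ (Σ₁.sum {p} f) ≈ Σ₂.sum (φ ∘ f)
  ∑-hom zero    f = φ-ε
  ∑-hom (suc p) f = trans (φ-∙ _ _) (∙-cong refl (∑-hom p _))

module ℕΣ = FiniteSums ℕₚ.+-0-commutativeMonoid
module ℤΣ = FiniteSums ℤₚ.+-0-commutativeMonoid

∑-const : ∀ p c → ℤΣ.sum {p} (λ _ → c) ≡ + p ℤ.* c
∑-const zero    c = ≡.refl
∑-const (suc p) c = ≡.trans (≡.cong (λ t → c ℤ.+ t) (∑-const p c)) (factor (+ p) c)
  where
  factor : ∀ a c → c ℤ.+ a ℤ.* c ≡ (+ 1 ℤ.+ a) ℤ.* c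
  factor = solve-∀

∑-[<] : ∀ p → ℤΣ.sum {suc p} (λ i → if does (toℕ i ℕ.<? p) then + 1 else + 0) ≡ + p
∑-[<] zero    = ≡.refl
∑-[<] (suc p) = ≡.cong (λ t → + 1 ℤ.+ t) (∑-[<] p)

+V-isAbelianGroup : ∀ n → IsAbelianGroup _≡_ (_+V_ {n}) zeroV id
+V-isAbelianGroup n = record
  { isGroup = record
    { isMonoid = record
      { isSemigroup = record
        { isMagma = record { isEquivalence = ≡.isEquivalence ; ∙-cong = ≡.cong₂ _+V_ }
        ; assoc = Vecₚ.zipWith-assoc 𝔹.xor-assoc }
      ; identity = Vecₚ.zipWith-identityˡ 𝔹.xor-identityˡ , Vecₚ.zipWith-identityʳ 𝔹.xor-identityʳ }
    ; inverse = +V-self , +V-self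
    ; ⁻¹-cong = id }
  ; comm = Vecₚ.zipWith-comm 𝔹.xor-comm }
  where
  +V-self : ∀ {n} (x : V n) → x +V x ≡ zeroV
  +V-self []      = ≡.refl
  +V-self (a ∷ x) = ≡.cong₂ _∷_ (𝔹.xor-same a) (+V-self x)

V-abelianGroup : ℕ → AbelianGroup 0ℓ 0ℓ
V-abelianGroup n = record { isAbelianGroup = +V-isAbelianGroup n }

module _ {n : ℕ} where
  open AbelianGroup (V-abelianGroup n) public using ()
    renaming (assoc to +V-assoc; comm to +V-comm; identityˡ to +V-identityˡ; identityʳ to +V-identityʳ;
              inverseʳ to +V-self)
  open CommutativeSemigroupProperties (AbelianGroup.commutativeSemigroup (V-abelianGroup n)) public
    using () renaming (interchange to +V-interchange)

  +V≡zeroV⇒≡ : ∀ {x y : V n} → x +V y ≡ zeroV → x ≡ y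
  +V≡zeroV⇒≡ = GroupProperties.x∙y⁻¹≈ε⇒x≈y (AbelianGroup.group (V-abelianGroup n)) _ _

+V-swap : ∀ {n} {a b c d : V n} → a +V b ≡ c +V d → a +V c ≡ b +V d
+V-swap {a = a} {b} {c} {d} eq = +V≡zeroV⇒≡
  (≡.trans (+V-interchange a c b d) (≡.trans (≡.cong (_+V (c +V d)) eq) (+V-self (c +V d))))

_≟V_ : ∀ {n} (x y : V n) → Dec (x ≡ y)
_≟V_ = Vecₚ.≡-dec 𝔹._≟_

any?V : ∀ l {Q : V l → Set} → (∀ z → Dec (Q z)) → Dec (∃ Q)
any?V zero    Q? = map′ ([] ,_) (λ { ([] , q) → q }) (Q? [])
any?V (suc l) Q? = map′
  (λ { (inj₁ (z , q)) → false ∷ z , q ; (inj₂ (z , q)) → true ∷ z , q })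
  (λ { (false ∷ z , q) → inj₁ (z , q) ; (true ∷ z , q) → inj₂ (z , q) })
  (any?V l (Q? ∘ (false ∷_)) ⊎-dec any?V l (Q? ∘ (true ∷_)))

does≡true⇒ : ∀ {A : Set} (a? : Dec A) → does a? ≡ true → A
does≡true⇒ (yes a) _  = a
does≡true⇒ (no _)  ()

comb-zeroV : ∀ {n l} (bs : Vec (V n) l) → comb bs zeroV ≡ zeroV
comb-zeroV []       = ≡.refl
comb-zeroV (b ∷ bs) = comb-zeroV bs

comb-+V : ∀ {n l} (bs : Vec (V n) l) (c d : V l) → comb bs (c +V d) ≡ comb bs c +V comb bs d
comb-+V []       []          []          = ≡.sym (+V-self zeroV)
comb-+V (b ∷ bs) (false ∷ c) (false ∷ d) = comb-+V bs c d
comb-+V (b ∷ bs) (false ∷ c) (true ∷ d)  = begin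
  b +V comb bs (c +V d)            ≡⟨ ≡.cong (b +V_) (comb-+V bs c d) ⟩
  b +V (comb bs c +V comb bs d)    ≡⟨ ≡.sym (+V-assoc b _ _) ⟩
  (b +V comb bs c) +V comb bs d    ≡⟨ ≡.cong (_+V comb bs d) (+V-comm b _) ⟩
  (comb bs c +V b) +V comb bs d    ≡⟨ +V-assoc _ b _ ⟩
  comb bs c +V (b +V comb bs d)    ∎
  where open ≡.≡-Reasoning
comb-+V (b ∷ bs) (true ∷ c)  (false ∷ d) =
  ≡.trans (≡.cong (b +V_) (comb-+V bs c d)) (≡.sym (+V-assoc b _ _))
comb-+V (b ∷ bs) (true ∷ c)  (true ∷ d)  = begin
  comb bs (c +V d)                           ≡⟨ comb-+V bs c d ⟩
  comb bs c +V comb bs d                     ≡⟨ ≡.sym (+V-identityˡ _) ⟩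
  zeroV +V (comb bs c +V comb bs d)          ≡⟨ ≡.cong (_+V _) (≡.sym (+V-self b)) ⟩
  (b +V b) +V (comb bs c +V comb bs d)       ≡⟨ +V-interchange b b (comb bs c) (comb bs d) ⟩
  (b +V comb bs c) +V (b +V comb bs d)       ∎
  where open ≡.≡-Reasoning

comb-++ : ∀ {n l l′} (bs : Vec (V n) l) (cs : Vec (V n) l′) c d →
          comb (bs ++ cs) (c ++ d) ≡ comb bs c +V comb cs d
comb-++ []       cs []          d = ≡.sym (+V-identityˡ _)
comb-++ (b ∷ bs) cs (false ∷ c) d = comb-++ bs cs c d
comb-++ (b ∷ bs) cs (true ∷ c)  d = ≡.trans (≡.cong (b +V_) (comb-++ bs cs c d)) (≡.sym (+V-assoc b _ _))

comb-injective : ∀ {n m} (U : Subspace n m) {c d : V m} →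
                 comb (Subspace.basis U) c ≡ comb (Subspace.basis U) d → c ≡ d
comb-injective U {c} {d} eq = +V≡zeroV⇒≡ (Subspace.independent U (c +V d)
  (≡.trans (comb-+V (Subspace.basis U) c d) (≡.trans (≡.cong (_+V _) eq) (+V-self _))))

_∈S?_ : ∀ {n m} (x : V n) (U : Subspace n m) → Dec (x ∈S U)
_∈S?_ {m = m} x U = any?V m (λ c → comb (Subspace.basis U) c ≟V x)

standardBasis : ∀ n → Vec (V n) n
standardBasis zero    = []
standardBasis (suc n) = (true ∷ zeroV) ∷ Vec.map (false ∷_) (standardBasis n)

comb-map-false∷ : ∀ {n l} (bs : Vec (V n) l) c → comb (Vec.map (false ∷_) bs) c ≡ false ∷ comb bs c
comb-map-false∷ []       []          = ≡.refl
comb-map-false∷ (b ∷ bs) (false ∷ c) = comb-map-false∷ bs c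
comb-map-false∷ (b ∷ bs) (true ∷ c)  = ≡.cong ((false ∷ b) +V_) (comb-map-false∷ bs c)

comb-standardBasis : ∀ n (c : V n) → comb (standardBasis n) c ≡ c
comb-standardBasis zero    []          = ≡.refl
comb-standardBasis (suc n) (false ∷ c) =
  ≡.trans (comb-map-false∷ (standardBasis n) c) (≡.cong (false ∷_) (comb-standardBasis n c))
comb-standardBasis (suc n) (true ∷ c)  =
  ≡.trans (≡.cong ((true ∷ zeroV) +V_) (comb-map-false∷ (standardBasis n) c))
          (≡.cong (true ∷_) (≡.trans (≡.cong (zeroV +V_) (comb-standardBasis n c)) (+V-identityˡ c)))

module Indicator {c ℓ} (M : CommutativeMonoid c ℓ) (one : CommutativeMonoid.Carrier M) where
  open CommutativeMonoid M
  open FiniteSums M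

  indicator : ∀ {n} → V n → V n → Carrier
  indicator y x = if does (y ≟V x) then one else ε

  indicator-same : ∀ {n} (x : V n) → indicator x x ≈ one
  indicator-same x rewrite dec-true (x ≟V x) ≡.refl = refl

  indicator-diff : ∀ {n} {y x : V n} → y ≢ x → indicator y x ≈ ε
  indicator-diff {y = y} {x} y≢x rewrite dec-false (y ≟V x) y≢x = refl

  ∑-indicator-image : ∀ l {n} (φ : V l → V n) → Injective _≡_ _≡_ φ →
                      ∀ {z x} → φ z ≡ x → ∑V l (λ z′ → indicator (φ z′) x) ≈ one
  ∑-indicator-image l φ φ-inj {z} {x} φz≡x =
    trans (∑V-single l z (λ z′ z′≢z → indicator-diff (z′≢z ∘ φ-inj ∘ λ e → ≡.trans e (≡.sym φz≡x))))
          (≡.subst (λ y → indicator y x ≈ one) (≡.sym φz≡x) (indicator-same x))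

  ∑-indicator-∉ : ∀ l {n} (φ : V l → V n) {x} → (∀ z → φ z ≢ x) → ∑V l (λ z → indicator (φ z) x) ≈ ε
  ∑-indicator-∉ l φ ∉ = ∑V-zero l (λ z → indicator-diff (∉ z))

2^-suc : ∀ n → 2 ^ suc n ≡ 2 ^ n ℕ.+ 2 ^ n
2^-suc n = ≡.cong (2 ^ n ℕ.+_) (ℕₚ.+-identityʳ (2 ^ n))

∑V-1≡2^ : ∀ n → ℕΣ.∑V n (λ _ → 1) ≡ 2 ^ n
∑V-1≡2^ zero    = ≡.refl
∑V-1≡2^ (suc n) = ≡.trans (≡.cong₂ ℕ._+_ (∑V-1≡2^ n) (∑V-1≡2^ n)) (≡.sym (2^-suc n))

∑V≤2^ : ∀ n (a : V n → ℕ) → (∀ x → a x ≤ 1) → ℕΣ.∑V n a ≤ 2 ^ n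
∑V≤2^ zero    a a≤1 = a≤1 []
∑V≤2^ (suc n) a a≤1 = ≡.subst (ℕΣ.∑V (suc n) a ≤_) (≡.sym (2^-suc n))
  (ℕₚ.+-mono-≤ (∑V≤2^ n _ (a≤1 ∘ (false ∷_))) (∑V≤2^ n _ (a≤1 ∘ (true ∷_))))

∑V<2^ : ∀ n (a : V n → ℕ) → (∀ x → a x ≤ 1) → ∀ x → a x ≡ 0 → ℕΣ.∑V n a < 2 ^ n
∑V<2^ zero    a a≤1 [] ax≡0 = ℕ.s≤s (ℕₚ.≤-reflexive ax≡0)
∑V<2^ (suc n) a a≤1 (false ∷ x) ax≡0 = ≡.subst (ℕΣ.∑V (suc n) a <_) (≡.sym (2^-suc n))
  (ℕₚ.+-mono-<-≤ (∑V<2^ n _ (a≤1 ∘ (false ∷_)) x ax≡0) (∑V≤2^ n _ (a≤1 ∘ (true ∷_))))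
∑V<2^ (suc n) a a≤1 (true ∷ x)  ax≡0 = ≡.subst (ℕΣ.∑V (suc n) a <_) (≡.sym (2^-suc n))
  (ℕₚ.+-mono-≤-< (∑V≤2^ n _ (a≤1 ∘ (false ∷_))) (∑V<2^ n _ (a≤1 ∘ (true ∷_)) x ax≡0))

-- Counting preimages: the 2^n preimage counts are each at most 1 and add up to 2^n.
injective⇒surjective : ∀ {l n} → l ≡ n → (φ : V l → V n) → Injective _≡_ _≡_ φ →
                       ∀ x → ∃ λ z → φ z ≡ x
injective⇒surjective {l} {n} ≡.refl φ φ-inj x with any?V l (λ z → φ z ≟V x)
... | yes image = image
... | no  ∉     = ⊥-elim (ℕₚ.<-irrefl total (∑V<2^ n preimages preimages≤1 x none))
  where
  open Indicator ℕₚ.+-0-commutativeMonoid 1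
  preimages : V n → ℕ
  preimages y = ℕΣ.∑V l (λ z → indicator (φ z) y)
  preimages≤1 : ∀ y → preimages y ≤ 1
  preimages≤1 y with any?V l (λ z → φ z ≟V y)
  ... | yes (z , φz≡y) = ℕₚ.≤-reflexive (∑-indicator-image l φ φ-inj φz≡y)
  ... | no  ∉y         = ≡.subst (_≤ 1) (≡.sym (∑-indicator-∉ l φ (λ z e → ∉y (z , e)))) ℕ.z≤n
  none : preimages x ≡ 0
  none = ∑-indicator-∉ l φ (λ z e → ∉ (z , e))
  total : ℕΣ.∑V n preimages ≡ 2 ^ n
  total = ≡.trans (ℕΣ.∑V-comm n l (λ y z → indicator (φ z) y))
    (≡.trans (ℕΣ.∑V-cong l (λ z → ≡.trans (ℕΣ.∑V-single n (φ z) (λ y y≢ → indicator-diff (y≢ ∘ ≡.sym)))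
                                          (indicator-same (φ z))))
             (∑V-1≡2^ n))

-- Orthogonality

sign : Bool → ℤ
sign false = + 1
sign true  = -1ℤ

sign-not : ∀ t → sign (not t) ≡ ℤ.- sign t
sign-not true  = ≡.refl
sign-not false = ≡.refl

sign-squared : ∀ t → sign t ℤ.* sign t ≡ + 1
sign-squared true  = ≡.refl
sign-squared false = ≡.refl

module ℤ-negate = SumHomomorphism ℤₚ.+-0-commutativeMonoid ℤₚ.+-0-commutativeMonoid
  ℤ.-_ ℤₚ.neg-distrib-+ ≡.refl

module ℤ-multiply (w : ℤ) = SumHomomorphism ℤₚ.+-0-commutativeMonoid ℤₚ.+-0-commutativeMonoid
  (w ℤ.*_) (ℤₚ.*-distribˡ-+ w) (ℤₚ.*-zeroʳ w)

module InnerProductProperties {n} (ip : InnerProduct n) where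
  open InnerProduct ip

  ·-zeroʳ : ∀ b → b · zeroV ≡ false
  ·-zeroʳ b = ≡.trans (≡.cong (b ·_) (≡.sym (+V-self zeroV)))
                      (≡.trans (linearʳ b zeroV zeroV) (𝔹.xor-same (b · zeroV)))

  ·-zeroˡ : ∀ y → zeroV · y ≡ false
  ·-zeroˡ y = ≡.trans (symmetric zeroV y) (·-zeroʳ y)

  orthogonal : V n → ∀ {l} → Vec (V n) l → Bool
  orthogonal b []       = true
  orthogonal b (v ∷ bs) = not (b · v) ∧ orthogonal b bs

  orthogonal-comb : ∀ b {l} (bs : Vec (V n) l) → orthogonal b bs ≡ true → ∀ c → b · comb bs c ≡ false
  orthogonal-comb b []       _ []          = ·-zeroʳ b
  orthogonal-comb b (v ∷ bs) o (false ∷ c) with b · v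
  ... | false = orthogonal-comb b bs o c
  orthogonal-comb b (v ∷ bs) o (true ∷ c)  with b · v in b·v≡
  ... | false = ≡.trans (linearʳ b v (comb bs c)) (≡.cong₂ _xor_ b·v≡ (orthogonal-comb b bs o c))

  orthogonal-zeroV : ∀ {l} (bs : Vec (V n) l) → orthogonal zeroV bs ≡ true
  orthogonal-zeroV []       = ≡.refl
  orthogonal-zeroV (v ∷ bs) rewrite ·-zeroˡ v = orthogonal-zeroV bs

  orthogonal-standardBasis⇒zeroV : ∀ b → orthogonal b (standardBasis n) ≡ true → b ≡ zeroV
  orthogonal-standardBasis⇒zeroV b o = nondegen b (λ y →
    ≡.subst (λ z → b · z ≡ false) (comb-standardBasis n y) (orthogonal-comb b (standardBasis n) o y))

  ∑-sign-span : ∀ b {l} (bs : Vec (V n) l) →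
    ℤΣ.∑V l (λ c → sign (b · comb bs c)) ≡ (if orthogonal b bs then + (2 ^ l) else + 0)
  ∑-sign-span b []               = ≡.cong sign (·-zeroʳ b)
  ∑-sign-span b {suc l} (v ∷ bs) =
    ≡.trans (≡.cong (λ t → S ℤ.+ t) (ℤΣ.∑V-cong l (λ c → ≡.cong sign (linearʳ b v (comb bs c)))))
            (split (b · v))
    where
    S = ℤΣ.∑V l (λ c → sign (b · comb bs c))
    split : ∀ t → S ℤ.+ ℤΣ.∑V l (λ c → sign (t xor (b · comb bs c)))
                  ≡ (if not t ∧ orthogonal b bs then + (2 ^ suc l) else + 0)
    split false rewrite ∑-sign-span b bs with orthogonal b bs
    ... | true  = ≡.trans (≡.sym (ℤₚ.pos-+ (2 ^ l) (2 ^ l))) (≡.cong +_ (≡.sym (2^-suc l)))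
    ... | false = ≡.refl
    split true = ≡.trans (≡.cong (λ t → S ℤ.+ t) (≡.trans (ℤΣ.∑V-cong l (λ c → sign-not _))
                                                   (≡.sym (ℤ-negate.∑V-hom l _))))
                         (ℤₚ.+-inverseʳ S)

module ComplementarySubspaces (m : ℕ) (ip : InnerProduct (2 * m)) where
  open InnerProduct ip
  open InnerProductProperties ip

  -- Two m-dimensional subspaces of V_2m meeting trivially span V_2m,
  -- so no nonzero vector is orthogonal to both.
  trivInt-orthogonal⇒zeroV : ∀ (U W : Subspace (2 * m) m) → TrivInt U W → ∀ b →
    orthogonal b (Subspace.basis U) ≡ true → orthogonal b (Subspace.basis W) ≡ true → b ≡ zeroV
  trivInt-orthogonal⇒zeroV U W U∩W≡0 b b⊥U b⊥W = nondegen b b⊥all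
    where
    bU = Subspace.basis U
    bW = Subspace.basis W

    sum-injective : ∀ {c d c′ d′} → comb bU c +V comb bW d ≡ comb bU c′ +V comb bW d′ → c ≡ c′ × d ≡ d′
    sum-injective {c} {d} {c′} {d′} eq =
        +V≡zeroV⇒≡ (Subspace.independent U (c +V c′) (≡.trans (comb-+V bU c c′) x≡0))
      , +V≡zeroV⇒≡ (Subspace.independent W (d +V d′) (≡.trans (comb-+V bW d d′) (≡.trans (≡.sym u≡w) x≡0)))
      where
      u≡w : comb bU c +V comb bU c′ ≡ comb bW d +V comb bW d′
      u≡w = +V-swap eq
      x≡0 : comb bU c +V comb bU c′ ≡ zeroV
      x≡0 = U∩W≡0 _ (c +V c′ , comb-+V bU c c′) (d +V d′ , ≡.trans (comb-+V bW d d′) (≡.sym u≡w))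

    φ : V (m ℕ.+ m) → V (2 * m)
    φ = comb (bU ++ bW)

    φ-injective : Injective _≡_ _≡_ φ
    φ-injective {z} {z′} eq with splitAt m z | splitAt m z′
    ... | c , d , ≡.refl | c′ , d′ , ≡.refl
      with sum-injective (≡.trans (≡.sym (comb-++ bU bW c d)) (≡.trans eq (comb-++ bU bW c′ d′)))
    ... | ≡.refl , ≡.refl = ≡.refl

    b⊥all : ∀ y → b · y ≡ false
    b⊥all y with injective⇒surjective (≡.cong (m ℕ.+_) (≡.sym (ℕₚ.+-identityʳ m))) φ φ-injective y
    ... | z , ≡.refl with splitAt m z
    ... | c , d , ≡.refl = ≡.trans (≡.cong (b ·_) (comb-++ bU bW c d))
      (≡.trans (linearʳ b _ _) (≡.cong₂ _xor_ (orthogonal-comb b bU b⊥U c) (orthogonal-comb b bW b⊥W d)))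

-- The cyclotomic ring ℤ[ζ]

module Cyclotomic (k′ : ℕ) where
  k = suc k′
  H = half k
  N = 2 ^ k
  C = Cyc k

  instance
    N-nonZero : ℕ.NonZero N
    N-nonZero = ℕₚ.m^n≢0 2 k
    H-nonZero : ℕ.NonZero H
    H-nonZero = ℕₚ.m^n≢0 2 k′

  N≡H+H : N ≡ H ℕ.+ H
  N≡H+H = 2^-suc k′

  H<N : H < N
  H<N = ≡.subst (H <_) (≡.sym N≡H+H) (ℕₚ.m<m+n H (ℕₚ.m^n>0 2 k′))

  ≋-refl : ∀ {a : C} → a ≋ a
  ≋-refl j = ≡.refl

  ≋-sym : ∀ {a b : C} → a ≋ b → b ≋ a
  ≋-sym a≋b j = ≡.sym (a≋b j)

  ≋-trans : ∀ {a b c : C} → a ≋ b → b ≋ c → a ≋ c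
  ≋-trans a≋b b≋c j = ≡.trans (a≋b j) (b≋c j)

  ⊞-cong : ∀ {a a′ b b′ : C} → a ≋ a′ → b ≋ b′ → (a ⊞ b) ≋ (a′ ⊞ b′)
  ⊞-cong a≋a′ b≋b′ j = ≡.cong₂ ℤ._+_ (a≋a′ j) (b≋b′ j)

  Cyc-commutativeMonoid : CommutativeMonoid 0ℓ 0ℓ
  Cyc-commutativeMonoid = record
    { Carrier = C ; _≈_ = _≋_ ; _∙_ = _⊞_ ; ε = 0C
    ; isCommutativeMonoid = record
      { isMonoid = record
        { isSemigroup = record
          { isMagma = record
            { isEquivalence = record { refl = ≋-refl ; sym = ≋-sym ; trans = ≋-trans }
            ; ∙-cong = ⊞-cong }
          ; assoc = λ a b c j → ℤₚ.+-assoc (coeff a j) (coeff b j) (coeff c j) }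
        ; identity = (λ a j → ℤₚ.+-identityˡ (coeff a j)) , (λ a j → ℤₚ.+-identityʳ (coeff a j)) }
      ; comm = λ a b j → ℤₚ.+-comm (coeff a j) (coeff b j) } }

  module CΣ = FiniteSums Cyc-commutativeMonoid
  open CommutativeMonoid Cyc-commutativeMonoid public using (setoid)
  module ≋-Reasoning = SetoidReasoning setoid

  sumV≋∑V : ∀ n f → sumV n f ≋ CΣ.∑V n f
  sumV≋∑V zero    f = ≋-refl
  sumV≋∑V (suc n) f = ⊞-cong (sumV≋∑V n _) (sumV≋∑V n _)

  sumFin≋∑ : ∀ p f → sumFin p f ≋ CΣ.sum f
  sumFin≋∑ zero    f = ≋-refl
  sumFin≋∑ (suc p) f = ⊞-cong (≋-refl {f fzero}) (sumFin≋∑ p _)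

  scale-cong : ∀ {y z} {a b : C} → y ≡ z → a ≋ b → scale y a ≋ scale z b
  scale-cong y≡z a≋b j = ≡.cong₂ ℤ._*_ y≡z (a≋b j)

  scale-congˡ : ∀ {y z} → y ≡ z → ∀ (a : C) → scale y a ≋ scale z a
  scale-congˡ y≡z a = scale-cong y≡z (≋-refl {a})

  scale-congʳ : ∀ z {a b : C} → a ≋ b → scale z a ≋ scale z b
  scale-congʳ z = scale-cong {z} ≡.refl

  scale-distribˡ : ∀ z (a b : C) → scale z (a ⊞ b) ≋ (scale z a ⊞ scale z b)
  scale-distribˡ z a b j = ℤₚ.*-distribˡ-+ z (coeff a j) (coeff b j)

  scale-distribʳ : ∀ y z (a : C) → scale (y ℤ.+ z) a ≋ (scale y a ⊞ scale z a)
  scale-distribʳ y z a j = ℤₚ.*-distribʳ-+ (coeff a j) y z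

  scale-assoc : ∀ y z (a : C) → scale y (scale z a) ≋ scale (y ℤ.* z) a
  scale-assoc y z a j = ≡.sym (ℤₚ.*-assoc y z (coeff a j))

  scale-zeroˡ : ∀ (a : C) → scale (+ 0) a ≋ 0C
  scale-zeroˡ a j = ≡.refl

  scale-zeroʳ : ∀ z → scale z (0C {k}) ≋ 0C
  scale-zeroʳ z j = ℤₚ.*-zeroʳ z

  scale-identityˡ : ∀ (a : C) → scale (+ 1) a ≋ a
  scale-identityˡ a j = ℤₚ.*-identityˡ (coeff a j)

  module Scale (z : ℤ) = SumHomomorphism Cyc-commutativeMonoid Cyc-commutativeMonoid
    (scale z) (scale-distribˡ z) (scale-zeroʳ z)
  module ScaleOf (a : C) = SumHomomorphism ℤₚ.+-0-commutativeMonoid Cyc-commutativeMonoid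
    (λ z → scale z a) (λ y z → scale-distribʳ y z a) (scale-zeroˡ a)

  open CommutativeMonoid Cyc-commutativeMonoid public using ()
    renaming (identityˡ to ⊞-identityˡ; identityʳ to ⊞-identityʳ)

  ∑∑ : ∀ {p q} → (Fin p → Fin q → C) → C
  ∑∑ F = CΣ.sum (λ i → CΣ.sum (F i))

  ∑∑-cong : ∀ {p q} {F G : Fin p → Fin q → C} → (∀ i j → F i j ≋ G i j) → ∑∑ F ≋ ∑∑ G
  ∑∑-cong F≋G = CΣ.sum-cong-≋ (λ i → CΣ.sum-cong-≋ (F≋G i))

  ∑V-scale : ∀ n (f : V n → ℤ) a → CΣ.∑V n (λ x → scale (f x) a) ≋ scale (ℤΣ.∑V n f) a
  ∑V-scale n f a = ≋-sym (ScaleOf.∑V-hom a n f)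

  ∑V-∑∑-scale : ∀ n {p q} (c : V n → Fin p → Fin q → ℤ) (v : Fin p → C) →
    CΣ.∑V n (λ x → ∑∑ (λ i j → scale (c x i j) (v i)))
      ≋ ∑∑ (λ i j → scale (ℤΣ.∑V n (λ x → c x i j)) (v i))
  ∑V-∑∑-scale n {p} {q} c v = ≋-trans (CΣ.∑V-∑-comm n p _) (CΣ.sum-cong-≋ (λ i →
    ≋-trans (CΣ.∑V-∑-comm n q _) (CΣ.sum-cong-≋ (λ j → ∑V-scale n (λ x → c x i j) (v i)))))

  scale-∑∑-scale : ∀ z {p q} (c : Fin p → Fin q → ℤ) (v : Fin p → C) →
    scale z (∑∑ (λ i j → scale (c i j) (v i))) ≋ ∑∑ (λ i j → scale (z ℤ.* c i j) (v i))
  scale-∑∑-scale z {p} {q} c v = ≋-trans (Scale.∑-hom z p _) (CΣ.sum-cong-≋ (λ i →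
    ≋-trans (Scale.∑-hom z q _) (CΣ.sum-cong-≋ (λ j → scale-assoc z (c i j) (v i)))))

  mod : ℕ → ℕ
  mod = mod2^ k

  mod<N : ∀ a → mod a < N
  mod<N a = ℕ÷.m%n<n a N

  mod-small : ∀ {a} → a < N → mod a ≡ a
  mod-small = ℕ÷.m<n⇒m%n≡m

  mod-+ˡ : ∀ a b → mod (a ℕ.+ b) ≡ mod (mod a ℕ.+ b)
  mod-+ˡ a b = ≡.trans (ℕ÷.%-distribˡ-+ a b N)
    (≡.sym (≡.trans (ℕ÷.%-distribˡ-+ (mod a) b N) (≡.cong (λ r → (r ℕ.+ b % N) % N) (ℕ÷.m%n%n≡m%n a N))))

  -- coeff (ζ^ k e) j ≡ coefficientOf (toℕ j) (mod e) holds by definition of ζ^.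
  coefficientOf : ℕ → ℕ → ℤ
  coefficientOf j r = if does (j ℕ.≟ r) then + 1 else if does ((j ℕ.+ H) ℕ.≟ r) then -1ℤ else + 0

  ζ^-cong : ∀ {a b} → mod a ≡ mod b → ζ^ k a ≋ ζ^ k b
  ζ^-cong eq j = ≡.cong (coefficientOf (toℕ j)) eq

  [_≡_] : ℕ → ℕ → ℤ
  [ j ≡ s ] = if does (j ℕ.≟ s) then + 1 else + 0

  j+H≢s : ∀ (j : Fin H) {s} → s < H → toℕ j ℕ.+ H ≢ s
  j+H≢s j s<H eq = ℕₚ.<⇒≢ (ℕₚ.<-≤-trans s<H (ℕₚ.m≤n+m H (toℕ j))) (≡.sym eq)

  coeff-ζ^-low : ∀ {s} → s < H → ∀ j → coeff (ζ^ k s) j ≡ [ toℕ j ≡ s ]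
  coeff-ζ^-low {s} s<H j = ≡.trans (≡.cong (coefficientOf (toℕ j)) (mod-small (ℕₚ.<-trans s<H H<N)))
    (≡.cong (λ b → if does (toℕ j ℕ.≟ s) then + 1 else if b then -1ℤ else + 0)
            (dec-false (toℕ j ℕ.+ H ℕ.≟ s) (j+H≢s j s<H)))

  coeff-ζ^-high : ∀ {s} → s < H → ∀ j → coeff (ζ^ k (s ℕ.+ H)) j ≡ ℤ.- [ toℕ j ≡ s ]
  coeff-ζ^-high {s} s<H j = ≡.trans (≡.cong (coefficientOf (toℕ j)) (mod-small s+H<N)) high
    where
    s+H<N : s ℕ.+ H < N
    s+H<N = ≡.subst (s ℕ.+ H <_) (≡.sym N≡H+H) (ℕₚ.+-monoˡ-< H s<H)
    j≢s+H : toℕ j ≢ s ℕ.+ H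
    j≢s+H = ℕₚ.<⇒≢ (ℕₚ.<-≤-trans (Finₚ.toℕ<n j) (ℕₚ.m≤n+m H s))
    high : coefficientOf (toℕ j) (s ℕ.+ H) ≡ ℤ.- [ toℕ j ≡ s ]
    high rewrite dec-false (toℕ j ℕ.≟ s ℕ.+ H) j≢s+H with toℕ j ℕ.≟ s
    ... | yes ≡.refl rewrite dec-true (toℕ j ℕ.+ H ℕ.≟ toℕ j ℕ.+ H) ≡.refl
                           | dec-true (toℕ j ℕ.≟ toℕ j) ≡.refl = ≡.refl
    ... | no  j≢s    rewrite dec-false (toℕ j ℕ.+ H ℕ.≟ s ℕ.+ H) (j≢s ∘ ℕₚ.+-cancelʳ-≡ H _ _)
                           | dec-false (toℕ j ℕ.≟ s) j≢s = ≡.refl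

  residue : ∀ {r} → r < N → ∃ λ s → ∃ λ t → s < H × r ≡ s ℕ.+ bitExp k t
  residue {r} r<N with r ℕ.<? H
  ... | yes r<H = r , false , r<H , ≡.sym (ℕₚ.+-identityʳ r)
  ... | no  r≮H = r ∸ H , true , ℕₚ.m<n+o⇒m∸n<o r H (≡.subst (r <_) N≡H+H r<N)
                , ≡.sym (ℕₚ.m∸n+n≡m (ℕₚ.≮⇒≥ r≮H))

  ζ^-+H : ∀ a → ζ^ k (a ℕ.+ H) ≋ scale -1ℤ (ζ^ k a)
  ζ^-+H a j with residue (mod<N a)
  ... | s , false , s<H , a≡s+0 = begin
    coeff (ζ^ k (a ℕ.+ H)) j   ≡⟨ ζ^-cong (≡.trans (mod-+ˡ a H) (≡.cong (λ r → mod (r ℕ.+ H)) a≡s)) j ⟩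
    coeff (ζ^ k (s ℕ.+ H)) j   ≡⟨ coeff-ζ^-high s<H j ⟩
    ℤ.- [ toℕ j ≡ s ]          ≡⟨ ≡.cong ℤ.-_ (≡.sym (coeff-ζ^-low s<H j)) ⟩
    ℤ.- coeff (ζ^ k s) j       ≡⟨ ≡.cong ℤ.-_ (ζ^-cong s≡a j) ⟩
    ℤ.- coeff (ζ^ k a) j       ≡⟨ ≡.sym (ℤₚ.-1*i≡-i _) ⟩
    -1ℤ ℤ.* coeff (ζ^ k a) j   ∎
    where
    open ≡.≡-Reasoning
    a≡s : mod a ≡ s
    a≡s = ≡.trans a≡s+0 (ℕₚ.+-identityʳ s)
    s≡a : mod s ≡ mod a
    s≡a = ≡.trans (mod-small (ℕₚ.<-trans s<H H<N)) (≡.sym a≡s)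
  ... | s , true , s<H , a≡s+H = begin
    coeff (ζ^ k (a ℕ.+ H)) j   ≡⟨ ζ^-cong (≡.trans (mod-+ˡ a H) (≡.cong (λ r → mod (r ℕ.+ H)) a≡s+H)) j ⟩
    coeff (ζ^ k (s ℕ.+ H ℕ.+ H)) j ≡⟨ ζ^-cong s+H+H≡s j ⟩
    coeff (ζ^ k s) j           ≡⟨ coeff-ζ^-low s<H j ⟩
    [ toℕ j ≡ s ]              ≡⟨ ≡.sym (ℤₚ.neg-involutive _) ⟩
    ℤ.- ℤ.- [ toℕ j ≡ s ]      ≡⟨ ≡.cong ℤ.-_ (≡.sym (coeff-ζ^-high s<H j)) ⟩
    ℤ.- coeff (ζ^ k (s ℕ.+ H)) j ≡⟨ ≡.cong ℤ.-_ (ζ^-cong s+H≡a j) ⟩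
    ℤ.- coeff (ζ^ k a) j       ≡⟨ ≡.sym (ℤₚ.-1*i≡-i _) ⟩
    -1ℤ ℤ.* coeff (ζ^ k a) j   ∎
    where
    open ≡.≡-Reasoning
    s+H<N : s ℕ.+ H < N
    s+H<N = ≡.subst (_< N) a≡s+H (mod<N a)
    s+H≡a : mod (s ℕ.+ H) ≡ mod a
    s+H≡a = ≡.trans (mod-small s+H<N) (≡.sym a≡s+H)
    s+H+H≡s : mod (s ℕ.+ H ℕ.+ H) ≡ mod s
    s+H+H≡s = ≡.trans (≡.cong mod (≡.trans (ℕₚ.+-assoc s H H) (≡.cong (s ℕ.+_) (≡.sym N≡H+H))))
                      (ℕ÷.[m+n]%n≡m%n s N)

  ζ^-+bitExp : ∀ a t → ζ^ k (a ℕ.+ bitExp k t) ≋ scale (sign t) (ζ^ k a)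
  ζ^-+bitExp a true    = ζ^-+H a
  ζ^-+bitExp a false j = ≡.trans (ζ^-cong (≡.cong mod (ℕₚ.+-identityʳ a)) j) (≡.sym (ℤₚ.*-identityˡ _))

  ζ^-as-basis : ∀ {E s} t → mod E ≡ s ℕ.+ bitExp k t → ζ^ k E ≋ scale (sign t) (ζ^ k s)
  ζ^-as-basis {E} {s} t E≡ = ≋-trans (ζ^-cong (≡.trans E≡ (≡.sym (mod-small (≡.subst (_< N) E≡ (mod<N E))))))
                                     (ζ^-+bitExp s t)

  coeff-monomial-≢ : ∀ {s} (s<H : s < H) y i → i ≢ fromℕ< s<H → coeff (scale y (ζ^ k s)) i ≡ + 0
  coeff-monomial-≢ {s} s<H y i i≢s = ≡.trans (≡.cong (y ℤ.*_) (≡.trans (coeff-ζ^-low s<H i) [i≡s]≡0))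
                                             (ℤₚ.*-zeroʳ y)
    where
    [i≡s]≡0 : [ toℕ i ≡ s ] ≡ + 0
    [i≡s]≡0 = ≡.cong (λ b → if b then + 1 else + 0) (dec-false (toℕ i ℕ.≟ s)
      (λ eq → i≢s (Finₚ.toℕ-injective (≡.trans eq (≡.sym (Finₚ.toℕ-fromℕ< s<H))))))

  coeff-monomial-≡ : ∀ {s} (s<H : s < H) y → coeff (scale y (ζ^ k s)) (fromℕ< s<H) ≡ y
  coeff-monomial-≡ {s} s<H y = ≡.trans (≡.cong (y ℤ.*_) (≡.trans (coeff-ζ^-low s<H (fromℕ< s<H)) [s≡s]≡1))
                                       (ℤₚ.*-identityʳ y)
    where
    [s≡s]≡1 : [ toℕ (fromℕ< s<H) ≡ s ] ≡ + 1
    [s≡s]≡1 = ≡.cong (λ b → if b then + 1 else + 0) (dec-true (toℕ (fromℕ< s<H) ℕ.≟ s) (Finₚ.toℕ-fromℕ< s<H))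

  sumFin-cong : ∀ p {f g : Fin p → C} → (∀ i → f i ≋ g i) → sumFin p f ≋ sumFin p g
  sumFin-cong p {f} {g} f≋g = ≋-trans (sumFin≋∑ p f) (≋-trans (CΣ.sum-cong-≋ f≋g) (≋-sym (sumFin≋∑ p g)))

  sumFin-single : ∀ {s} (s<H : s < H) {F : Fin H → C} →
                  (∀ i → i ≢ fromℕ< s<H → F i ≋ 0C) → sumFin H F ≋ F (fromℕ< s<H)
  sumFin-single s<H {F} F≋0 = ≋-trans (sumFin≋∑ H F) (CΣ.∑-single (fromℕ< s<H) F≋0)

  ⊠-cong : ∀ {a a′ b b′ : C} → a ≋ a′ → b ≋ b′ → (a ⊠ b) ≋ (a′ ⊠ b′)
  ⊠-cong a≋a′ b≋b′ = sumFin-cong H (λ i → sumFin-cong H (λ j →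
    scale-cong (≡.cong₂ ℤ._*_ (a≋a′ i) (b≋b′ j)) ≋-refl))

  conj-cong : ∀ {a a′ : C} → a ≋ a′ → conj a ≋ conj a′
  conj-cong a≋a′ = sumFin-cong H (λ i → scale-cong (a≋a′ i) ≋-refl)

  conj-monomial : ∀ {s} (s<H : s < H) y → conj (scale y (ζ^ k s)) ≋ scale y (ζ^ k (N ∸ s))
  conj-monomial s<H y = ≋-trans
    (sumFin-single s<H (λ i i≢s → scale-congˡ (coeff-monomial-≢ s<H y i i≢s) (ζ^ k (N ∸ toℕ i))))
    (scale-cong (coeff-monomial-≡ s<H y) (ζ^-cong (≡.cong (λ t → mod (N ∸ t)) (Finₚ.toℕ-fromℕ< s<H))))

  monomial-⊠-monomial : ∀ {s t} (s<H : s < H) (t<H : t < H) y z →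
    (scale y (ζ^ k s) ⊠ scale z (ζ^ k t)) ≋ scale (y ℤ.* z) (ζ^ k (s ℕ.+ t))
  monomial-⊠-monomial {s} {t} s<H t<H y z = ≋-trans
    (sumFin-single s<H (λ i i≢s → ≋-trans (sumFin≋∑ H _) (CΣ.∑-zero (λ j →
      scale-cong (≡.cong (ℤ._* coeff (scale z (ζ^ k t)) j) (coeff-monomial-≢ s<H y i i≢s)) ≋-refl))))
    (≋-trans
      (sumFin-single t<H (λ j j≢t → ≋-trans
        (scale-cong (≡.trans (≡.cong (coeff (scale y (ζ^ k s)) (fromℕ< s<H) ℤ.*_) (coeff-monomial-≢ t<H z j j≢t))
                             (ℤₚ.*-zeroʳ (coeff (scale y (ζ^ k s)) (fromℕ< s<H)))) ≋-refl)
        (scale-zeroˡ (ζ^ k (toℕ (fromℕ< s<H) ℕ.+ toℕ j)))))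
      (scale-cong (≡.cong₂ ℤ._*_ (coeff-monomial-≡ s<H y) (coeff-monomial-≡ t<H z))
                  (ζ^-cong (≡.cong mod (≡.cong₂ ℕ._+_ (Finₚ.toℕ-fromℕ< s<H) (Finₚ.toℕ-fromℕ< t<H))))))

  mod-+-complement : ∀ {s r} → s ≤ N → mod (N ∸ s) ≡ r → mod (s ℕ.+ r) ≡ mod 0
  mod-+-complement {s} {r} s≤N N∸s≡r = begin
    mod (s ℕ.+ r)           ≡⟨ ≡.cong (λ r → mod (s ℕ.+ r)) (≡.sym N∸s≡r) ⟩
    mod (s ℕ.+ mod (N ∸ s)) ≡⟨ ≡.cong mod (ℕₚ.+-comm s _) ⟩
    mod (mod (N ∸ s) ℕ.+ s) ≡⟨ ≡.sym (mod-+ˡ (N ∸ s) s) ⟩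
    mod (N ∸ s ℕ.+ s)       ≡⟨ ≡.cong mod (ℕₚ.m∸n+n≡m s≤N) ⟩
    mod N                   ≡⟨ ℕ÷.n%n≡0 N ⟩
    0                       ≡⟨ ≡.sym (ℕ÷.m*n%n≡0 0 N) ⟩
    mod 0                   ∎
    where open ≡.≡-Reasoning

  -- Write ζ^E = ±ζ^s and ζ^(N-s) = τ ζ^s′ with s, s′ < H; then ζ^(s+s′) = τ because ζ^N = 1.
  unit-multiple-norm : ∀ z E {S : C} → S ≋ scale z (ζ^ k E) → (S ⊠ conj S) ≋ constC (z ℤ.* z)
  unit-multiple-norm z E {S} S≋zζ^E with residue (mod<N E)
  ... | s , t , s<H , E≡ with residue (mod<N (N ∸ s))
  ... | s′ , t′ , s′<H , N∸s≡ = begin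
    S ⊠ conj S                                    ≈⟨ ⊠-cong S≋yζ^s (conj-cong S≋yζ^s) ⟩
    scale y (ζ^ k s) ⊠ conj (scale y (ζ^ k s))    ≈⟨ ⊠-cong (≋-refl {scale y (ζ^ k s)}) conj≋ ⟩
    scale y (ζ^ k s) ⊠ scale (y ℤ.* τ) (ζ^ k s′)  ≈⟨ monomial-⊠-monomial s<H s′<H y (y ℤ.* τ) ⟩
    scale (y ℤ.* (y ℤ.* τ)) (ζ^ k (s ℕ.+ s′))     ≈⟨ scale-congʳ (y ℤ.* (y ℤ.* τ)) ζ^[s+s′]≋τ ⟩
    scale (y ℤ.* (y ℤ.* τ)) (scale τ (ζ^ k 0))    ≈⟨ scale-assoc (y ℤ.* (y ℤ.* τ)) τ (ζ^ k 0) ⟩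
    scale (y ℤ.* (y ℤ.* τ) ℤ.* τ) (ζ^ k 0)        ≈⟨ scale-cong coefficient ≋-refl ⟩
    constC (z ℤ.* z)                              ∎
    where
    open ≋-Reasoning
    y = z ℤ.* sign t
    τ = sign t′
    S≋yζ^s : S ≋ scale y (ζ^ k s)
    S≋yζ^s = ≋-trans S≋zζ^E (≋-trans (scale-congʳ z (ζ^-as-basis t E≡)) (scale-assoc z (sign t) _))
    conj≋ : conj (scale y (ζ^ k s)) ≋ scale (y ℤ.* τ) (ζ^ k s′)
    conj≋ = ≋-trans (conj-monomial s<H y) (≋-trans (scale-congʳ y (ζ^-as-basis t′ N∸s≡)) (scale-assoc y τ _))
    s+s′+b≡0 : mod (s ℕ.+ s′ ℕ.+ bitExp k t′) ≡ mod 0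
    s+s′+b≡0 = ≡.trans (≡.cong mod (ℕₚ.+-assoc s s′ _))
                       (mod-+-complement (ℕₚ.<⇒≤ (ℕₚ.<-trans s<H H<N)) N∸s≡)
    ζ^[s+s′]≋τ : ζ^ k (s ℕ.+ s′) ≋ scale τ (ζ^ k 0)
    ζ^[s+s′]≋τ = ≋-sym (≋-trans (scale-congʳ τ (≋-trans (ζ^-cong (≡.sym s+s′+b≡0)) (ζ^-+bitExp _ t′)))
                       (≋-trans (scale-assoc τ τ _) (≋-trans (scale-cong (sign-squared t′) ≋-refl) (scale-identityˡ _))))
    coefficient : y ℤ.* (y ℤ.* τ) ℤ.* τ ≡ z ℤ.* z
    coefficient = ≡.trans (reassociate z (sign t) τ)
      (≡.trans (≡.cong₂ (λ a b → z ℤ.* z ℤ.* (a ℤ.* b)) (sign-squared t) (sign-squared t′)) (ℤₚ.*-identityʳ _))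
      where
      reassociate : ∀ z σ τ →
                    z ℤ.* σ ℤ.* (z ℤ.* σ ℤ.* τ) ℤ.* τ ≡ z ℤ.* z ℤ.* (σ ℤ.* σ ℤ.* (τ ℤ.* τ))
      reassociate = solve-∀

  mod-below-2N : ∀ {a} → a < N ℕ.+ N → (a < N × mod a ≡ a) ⊎ (N ≤ a × mod a ≡ a ∸ N)
  mod-below-2N {a} a<2N with a ℕ.<? N
  ... | yes a<N = inj₁ (a<N , mod-small a<N)
  ... | no  a≮N = inj₂ (N≤a , ≡.trans (≡.cong mod (≡.sym (ℕₚ.m∸n+n≡m N≤a)))
                                (≡.trans (ℕ÷.[m+n]%n≡m%n (a ∸ N) N) (mod-small (ℕₚ.m<n+o⇒m∸n<o a N a<2N))))
    where N≤a = ℕₚ.≮⇒≥ a≮N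

  r≡mod[r+r]⇒r≡0 : ∀ {r} → r < N → r ≡ mod (r ℕ.+ r) → r ≡ 0
  r≡mod[r+r]⇒r≡0 {r} r<N r≡ with mod-below-2N (ℕₚ.+-mono-< r<N r<N)
  ... | inj₁ (_ , eq) =
        ℕₚ.+-cancelˡ-≡ r r 0 (≡.trans (≡.sym eq) (≡.trans (≡.sym r≡) (≡.sym (ℕₚ.+-identityʳ r))))
  ... | inj₂ (N≤r+r , eq) = ⊥-elim (ℕₚ.<⇒≢ r<N (ℕₚ.+-cancelˡ-≡ r r N
        (≡.trans (≡.sym (ℕₚ.m∸n+n≡m N≤r+r)) (≡.cong (ℕ._+ N) (≡.trans (≡.sym eq) (≡.sym r≡))))))

-- Characters of B

last-nonzero : ∀ (f : ℕ → ℕ) K → f 0 ≢ 0 → f K ≡ 0 → ∃ λ t → f t ≢ 0 × f (suc t) ≡ 0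
last-nonzero f zero    f0≢0 fK≡0 = ⊥-elim (f0≢0 fK≡0)
last-nonzero f (suc K) f0≢0 fK≡0 with f K ℕ.≟ 0
... | yes fK≡0′ = last-nonzero f K f0≢0 fK≡0′
... | no  fK≢0  = K , fK≢0 , fK≡0

i≡-i⇒i≡0 : ∀ i → i ≡ ℤ.- i → i ≡ + 0
i≡-i⇒i≡0 (+ zero)  _  = ≡.refl
i≡-i⇒i≡0 (+ suc n) ()
i≡-i⇒i≡0 -[1+ n ]  ()

module CharacterSum (k′ : ℕ) (B : AbGroupOfOrder2^ (suc k′)) (χ : Character B) where
  open Cyclotomic k′
  open AbGroupOfOrder2^ B
  open IsAbelianGroup isAbelianGroup using (assoc; identityˡ; identityʳ; inverseˡ; inverseʳ)

  e : Fin N → ℕ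
  e = Character.exponent χ

  mod-hom : ∀ a b → mod (e (a ⊕ b)) ≡ mod (mod (e a) ℕ.+ mod (e b))
  mod-hom a b = ≡.trans (Character.homo χ a b) (ℕ÷.%-distribˡ-+ (e a) (e b) N)

  mod-χ𝟘≡0 : mod (e 𝟘) ≡ 0
  mod-χ𝟘≡0 = r≡mod[r+r]⇒r≡0 (mod<N (e 𝟘))
    (≡.trans (≡.cong (mod ∘ e) (≡.sym (identityˡ 𝟘))) (mod-hom 𝟘 𝟘))

  doubled : ℕ → Fin N → Fin N
  doubled zero    a = a
  doubled (suc t) a = doubled t a ⊕ doubled t a

  mod-χ-doubled : ∀ t a → mod (e (doubled t a)) ≡ mod (2 ^ t ℕ.* e a)
  mod-χ-doubled zero    a = ≡.cong mod (≡.sym (ℕₚ.+-identityʳ (e a)))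
  mod-χ-doubled (suc t) a = begin
    mod (e (doubled t a ⊕ doubled t a))          ≡⟨ mod-hom (doubled t a) (doubled t a) ⟩
    mod (mod (e (doubled t a)) ℕ.+ mod (e (doubled t a)))
      ≡⟨ ≡.cong₂ (λ p q → mod (p ℕ.+ q)) (mod-χ-doubled t a) (mod-χ-doubled t a) ⟩
    mod (mod u ℕ.+ mod u)                        ≡⟨ ≡.sym (ℕ÷.%-distribˡ-+ u u N) ⟩
    mod (u ℕ.+ u)                                ≡⟨ ≡.cong mod (≡.sym (≡.trans (ℕₚ.*-assoc 2 (2 ^ t) (e a))
                                                      (≡.cong (u ℕ.+_) (ℕₚ.+-identityʳ u)))) ⟩
    mod (2 ^ suc t ℕ.* e a)                      ∎
    where
    open ≡.≡-Reasoning
    u = 2 ^ t ℕ.* e a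

  -- Doubling a until its value vanishes, the last nonzero value is an s with s + s ≡ N.
  value-H : Nontrivial χ → ∃ λ a → mod (e a) ≡ H
  value-H (a , χa≢0) = doubled t a , ℕₚ.*-cancelˡ-≡ s H 2 (≡.trans 2s≡s+s (≡.trans s+s≡N (≡.sym 2H≡N)))
    where
    R : ℕ → ℕ
    R t = mod (e (doubled t a))
    R[k]≡0 : R (suc k′) ≡ 0
    R[k]≡0 = ≡.trans (mod-χ-doubled (suc k′) a)
                     (≡.trans (≡.cong mod (ℕₚ.*-comm N (e a))) (ℕ÷.m*n%n≡0 (e a) N))
    last = last-nonzero R (suc k′) χa≢0 R[k]≡0
    t = proj₁ last
    s = R t
    s≢0 = proj₁ (proj₂ last)
    mod[s+s]≡0 : mod (s ℕ.+ s) ≡ 0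
    mod[s+s]≡0 = ≡.trans (≡.sym (mod-hom (doubled t a) (doubled t a))) (proj₂ (proj₂ last))
    s+s≡N : s ℕ.+ s ≡ N
    s+s≡N with mod-below-2N (ℕₚ.+-mono-< (mod<N (e (doubled t a))) (mod<N (e (doubled t a))))
    ... | inj₁ (_ , eq)      = ⊥-elim (s≢0 (ℕₚ.m+n≡0⇒m≡0 s (≡.trans (≡.sym eq) mod[s+s]≡0)))
    ... | inj₂ (N≤s+s , eq) = ℕₚ.≤-antisym (ℕₚ.m∸n≡0⇒m≤n (≡.trans (≡.sym eq) mod[s+s]≡0)) N≤s+s
    2s≡s+s : 2 ℕ.* s ≡ s ℕ.+ s
    2s≡s+s = ≡.cong (s ℕ.+_) (ℕₚ.+-identityʳ s)
    2H≡N : 2 ℕ.* H ≡ N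
    2H≡N = ≡.refl

  ζ^χ-shift : ∀ {a} → mod (e a) ≡ H → ∀ γ → ζ^ k (e (γ ⊕ a)) ≋ scale -1ℤ (ζ^ k (e γ))
  ζ^χ-shift {a} a↦H γ = ≋-trans (ζ^-cong mod≡) (ζ^-+H (e γ))
    where
    mod≡ : mod (e (γ ⊕ a)) ≡ mod (e γ ℕ.+ H)
    mod≡ = ≡.trans (mod-hom γ a)
      (≡.trans (≡.cong (λ h → mod (mod (e γ) ℕ.+ h)) (≡.trans a↦H (≡.sym (mod-small H<N))))
               (≡.sym (ℕ÷.%-distribˡ-+ (e γ) H N)))

  -- Translating by an a with χ(a) = -1 negates the sum.
  ∑-ζ^χ≋0 : Nontrivial χ → CΣ.sum (λ γ → ζ^ k (e γ)) ≋ 0C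
  ∑-ζ^χ≋0 nt j = i≡-i⇒i≡0 _ (≡.trans (T≋-T j) (ℤₚ.-1*i≡-i _))
    where
    open ≋-Reasoning
    a = proj₁ (value-H nt)
    translation : Perm.Permutation N N
    translation = Perm.permutation (_⊕ a) (_⊕ ⊖ a)
      (λ γ → ≡.trans (assoc γ (⊖ a) a) (≡.trans (≡.cong (γ ⊕_) (inverseˡ a)) (identityʳ γ)))
      (λ γ → ≡.trans (assoc γ a (⊖ a)) (≡.trans (≡.cong (γ ⊕_) (inverseʳ a)) (identityʳ γ)))
    T = CΣ.sum (λ γ → ζ^ k (e γ))
    T≋-T : T ≋ scale -1ℤ T
    T≋-T = begin
      T                                          ≈⟨ CΣ.∑-permute (λ γ → ζ^ k (e γ)) translation ⟩
      CΣ.sum (λ γ → ζ^ k (e (γ ⊕ a)))            ≈⟨ CΣ.sum-cong-≋ (ζ^χ-shift (proj₂ (value-H nt))) ⟩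
      CΣ.sum (λ γ → scale -1ℤ (ζ^ k (e γ)))      ≈⟨ Scale.∑-hom -1ℤ N _ ⟨
      scale -1ℤ T                                ∎

-- Walsh spectrum of a function built from a partial spread

record SpreadFunction (m : ℕ) {k} (B : AbGroupOfOrder2^ k) (h : V (2 * m) → Fin (2 ^ k)) : Set where
  field
    q         : ℕ
    U         : Fin (2 ^ k) → Fin q → Subspace (2 * m) m
    used      : Fin (2 ^ k) → Fin q → Bool
    spread    : ∀ γ i γ′ j → used γ i ≡ true → used γ′ j ≡ true → (γ , i) ≢ (γ′ , j) →
                TrivInt (U γ i) (U γ′ j)
    γ₀        : Fin (2 ^ k)
    h-zeroV   : h zeroV ≡ γ₀
    h-inside  : ∀ γ i x → used γ i ≡ true → x ≢ zeroV → x ∈S U γ i → h x ≡ γ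
    h-outside : ∀ x → x ≢ zeroV → (∀ γ i → used γ i ≡ true → ¬ x ∈S U γ i) → h x ≡ AbGroupOfOrder2^.𝟘 B

  weight : Fin (2 ^ k) → Fin q → ℤ
  weight γ i = if used γ i then + 1 else + 0

  [_≡γ₀] : Fin (2 ^ k) → ℤ
  [ γ ≡γ₀] = if does (γ Fin.≟ γ₀) then + 1 else + 0

  Balanced : ℕ → Set
  Balanced p = ∀ γ → γ ≢ AbGroupOfOrder2^.𝟘 B → ℤΣ.sum (weight γ) ≡ + p ℤ.+ [ γ ≡γ₀]

module SpreadWalshSpectrum (m k′ : ℕ) (ip : InnerProduct (2 * m)) (B : AbGroupOfOrder2^ (suc k′))
                           (χ : Character B) (χ-nontrivial : Nontrivial χ) where
  open Cyclotomic k′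
  open CharacterSum k′ B χ
  open InnerProduct ip using (_·_)
  open InnerProductProperties ip
  open ComplementarySubspaces m ip
  open Indicator ℤₚ.+-0-commutativeMonoid (+ 1)
  open AbGroupOfOrder2^ B using (𝟘)

  n = 2 * m

  M : ℤ
  M = + (2 ^ m)

  one : C
  one = ζ^ k 0

  2^n≡M*M : + (2 ^ n) ≡ M ℤ.* M
  2^n≡M*M = ≡.trans (≡.cong +_ (≡.trans (≡.cong (λ l → 2 ^ (m ℕ.+ l)) (ℕₚ.+-identityʳ m))
                                        (ℕₚ.^-distribˡ-+-* 2 m m)))
                    (ℤₚ.pos-* (2 ^ m) (2 ^ m))

  ε : Fin N → C
  ε γ = ζ^ k (e γ) ⊞ scale -1ℤ one

  ζ^χ𝟘≋one : ζ^ k (e 𝟘) ≋ one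
  ζ^χ𝟘≋one = ζ^-cong (≡.trans mod-χ𝟘≡0 (≡.sym (ℕ÷.m*n%n≡0 0 N)))

  ε𝟘≋0C : ε 𝟘 ≋ 0C
  ε𝟘≋0C j = ≡.trans (≡.cong (ℤ._+ -1ℤ ℤ.* coeff one j) (ζ^χ𝟘≋one j))
    (≡.trans (≡.cong (λ t → coeff one j ℤ.+ t) (ℤₚ.-1*i≡-i (coeff one j))) (ℤₚ.+-inverseʳ (coeff one j)))

  scale-ε𝟘 : ∀ z → scale z (ε 𝟘) ≋ 0C
  scale-ε𝟘 z = ≋-trans (scale-congʳ z ε𝟘≋0C) (scale-zeroʳ z)

  one⊞ε : ∀ γ → (one ⊞ ε γ) ≋ ζ^ k (e γ)
  one⊞ε γ j = cancel (coeff one j) (coeff (ζ^ k (e γ)) j)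
    where
    cancel : ∀ a b → a ℤ.+ (b ℤ.+ -1ℤ ℤ.* a) ≡ b
    cancel = solve-∀

  ∑ε : CΣ.sum ε ≋ scale (ℤ.- + N) one
  ∑ε = begin
    CΣ.sum ε                                      ≈⟨ CΣ.∑-distrib-+ (ζ^ k ∘ e) (λ _ → scale -1ℤ one) ⟩
    CΣ.sum (ζ^ k ∘ e) ⊞ CΣ.sum {N} (λ _ → scale -1ℤ one)
      ≈⟨ ⊞-cong (∑-ζ^χ≋0 χ-nontrivial) (≋-sym (ScaleOf.∑-hom one N (λ _ → -1ℤ))) ⟩
    0C ⊞ scale -N one                             ≈⟨ ⊞-identityˡ (scale -N one) ⟩
    scale -N one                                  ≈⟨ scale-congˡ (∑-const N -1ℤ) one ⟩
    scale (+ N ℤ.* -1ℤ) one                       ≈⟨ scale-congˡ (ℤₚ.*-comm (+ N) -1ℤ) one ⟩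
    scale (-1ℤ ℤ.* + N) one                       ≈⟨ scale-congˡ (ℤₚ.-1*i≡-i (+ N)) one ⟩
    scale (ℤ.- + N) one                           ∎
    where
    open ≋-Reasoning
    -N = ℤΣ.sum {N} (λ _ → -1ℤ)

  ∑V-*-indicator : ∀ (f : V n → ℤ) y → ℤΣ.∑V n (λ x → f x ℤ.* indicator y x) ≡ f y
  ∑V-*-indicator f y = ≡.trans
    (ℤΣ.∑V-single n y (λ x x≢y →
      ≡.trans (≡.cong (f x ℤ.*_) (indicator-diff (x≢y ∘ ≡.sym))) (ℤₚ.*-zeroʳ (f x))))
    (≡.trans (≡.cong (f y ℤ.*_) (indicator-same y)) (ℤₚ.*-identityʳ (f y)))

  [_∈_] : V n → Subspace n m → ℤ
  [ x ∈ U ] = ℤΣ.∑V m (λ c → indicator (comb (Subspace.basis U) c) x)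

  [∈]≡1 : ∀ {x} U → x ∈S U → [ x ∈ U ] ≡ + 1
  [∈]≡1 U (c , eq) = ∑-indicator-image m (comb (Subspace.basis U)) (comb-injective U) eq

  [∉]≡0 : ∀ {x} U → ¬ x ∈S U → [ x ∈ U ] ≡ + 0
  [∉]≡0 U x∉U = ∑-indicator-∉ m (comb (Subspace.basis U)) (λ c eq → x∉U (c , eq))

  [_≡0] : V n → ℤ
  [ x ≡0] = indicator zeroV x

  [≢0]≡0 : ∀ {x} → x ≢ zeroV → [ x ≡0] ≡ + 0
  [≢0]≡0 x≢0 = indicator-diff (x≢0 ∘ ≡.sym)

  module _ {h : V n → Fin N} (F : SpreadFunction m B h) where
    open SpreadFunction F

    coefficient : V n → Fin N → Fin q → ℤ
    coefficient x γ i = weight γ i ℤ.* ([ x ∈ U γ i ] ℤ.- [ x ≡0])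

    expansion : V n → C
    expansion x = one ⊞ (∑∑ (λ γ i → scale (coefficient x γ i) (ε γ)) ⊞ scale [ x ≡0] (ε γ₀))

    coefficient≡0 : ∀ {x} γ i → x ≢ zeroV → (used γ i ≡ true → ¬ x ∈S U γ i) → coefficient x γ i ≡ + 0
    coefficient≡0 {x} γ i x≢0 ∉ with used γ i
    ... | false = ≡.refl
    ... | true  rewrite [∉]≡0 (U γ i) (∉ ≡.refl) | [≢0]≡0 x≢0 = ≡.refl

    expansion-zeroV : expansion zeroV ≋ ζ^ k (e γ₀)
    expansion-zeroV = begin
      expansion zeroV     ≈⟨ ⊞-cong (≋-refl {one}) (⊞-cong (CΣ.∑∑-zero term≋0) scale[0≡0]) ⟩
      one ⊞ (0C ⊞ ε γ₀)   ≈⟨ ⊞-cong (≋-refl {one}) (⊞-identityˡ (ε γ₀)) ⟩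
      one ⊞ ε γ₀          ≈⟨ one⊞ε γ₀ ⟩
      ζ^ k (e γ₀)         ∎
      where
      open ≋-Reasoning
      [0∈U]≡1 : ∀ γ i → [ zeroV ∈ U γ i ] ≡ + 1
      [0∈U]≡1 γ i = [∈]≡1 (U γ i) (zeroV , comb-zeroV (Subspace.basis (U γ i)))
      term≋0 : ∀ γ i → scale (coefficient zeroV γ i) (ε γ) ≋ 0C
      term≋0 γ i = scale-congˡ
        (≡.trans (≡.cong₂ (λ a d → weight γ i ℤ.* (a ℤ.- d)) ([0∈U]≡1 γ i) (indicator-same {n} zeroV))
                 (ℤₚ.*-zeroʳ (weight γ i)))
        (ε γ)
      scale[0≡0] : scale [ zeroV ≡0] (ε γ₀) ≋ ε γ₀
      scale[0≡0] = ≋-trans (scale-congˡ (indicator-same {n} zeroV) (ε γ₀)) (scale-identityˡ (ε γ₀))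

    expansion-inside : ∀ {x γ i} → x ≢ zeroV → used γ i ≡ true → x ∈S U γ i → expansion x ≋ ζ^ k (e γ)
    expansion-inside {x} {γ} {i} x≢0 u x∈U = begin
      expansion x        ≈⟨ ⊞-cong (≋-refl {one}) (⊞-cong ∑∑≋ε (scale-congˡ ([≢0]≡0 x≢0) (ε γ₀))) ⟩
      one ⊞ (ε γ ⊞ 0C)   ≈⟨ ⊞-cong (≋-refl {one}) (⊞-identityʳ (ε γ)) ⟩
      one ⊞ ε γ          ≈⟨ one⊞ε γ ⟩
      ζ^ k (e γ)         ∎
      where
      open ≋-Reasoning
      ∉-elsewhere : ∀ γ′ i′ → (γ′ , i′) ≢ (γ , i) → used γ′ i′ ≡ true → ¬ x ∈S U γ′ i′
      ∉-elsewhere γ′ i′ ne u′ x∈U′ = x≢0 (spread γ′ i′ γ i u′ u ne x x∈U′ x∈U)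
      coefficient≡1 : coefficient x γ i ≡ + 1
      coefficient≡1 rewrite u | [∈]≡1 (U γ i) x∈U | [≢0]≡0 x≢0 = ≡.refl
      ∑∑≋ε : ∑∑ (λ γ′ i′ → scale (coefficient x γ′ i′) (ε γ′)) ≋ ε γ
      ∑∑≋ε = ≋-trans
        (CΣ.∑∑-single γ i (λ γ′ i′ ne →
          scale-congˡ (coefficient≡0 γ′ i′ x≢0 (∉-elsewhere γ′ i′ ne)) (ε γ′)))
        (≋-trans (scale-congˡ coefficient≡1 (ε γ)) (scale-identityˡ (ε γ)))

    expansion-outside : ∀ {x} → x ≢ zeroV → (∀ γ i → used γ i ≡ true → ¬ x ∈S U γ i) → expansion x ≋ one
    expansion-outside {x} x≢0 ∉ = begin
      expansion x       ≈⟨ ⊞-cong (≋-refl {one}) (⊞-cong ∑∑≋0 (scale-congˡ ([≢0]≡0 x≢0) (ε γ₀))) ⟩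
      one ⊞ (0C ⊞ 0C)   ≈⟨ ⊞-cong (≋-refl {one}) (⊞-identityˡ 0C) ⟩
      one ⊞ 0C          ≈⟨ ⊞-identityʳ one ⟩
      one               ∎
      where
      open ≋-Reasoning
      ∑∑≋0 : ∑∑ (λ γ i → scale (coefficient x γ i) (ε γ)) ≋ 0C
      ∑∑≋0 = CΣ.∑∑-zero (λ γ i → scale-congˡ (coefficient≡0 γ i x≢0 (∉ γ i)) (ε γ))

    ζ^χh≋expansion : ∀ x → ζ^ k (e (h x)) ≋ expansion x
    ζ^χh≋expansion x = by-cases (x ≟V zeroV)
      (Finₚ.any? (λ γ → Finₚ.any? (λ i → (used γ i 𝔹.≟ true) ×-dec (x ∈S? U γ i))))
      where
      ζ^χ-cong : ∀ {γ γ′} → γ ≡ γ′ → ζ^ k (e γ) ≋ ζ^ k (e γ′)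
      ζ^χ-cong = ζ^-cong ∘ ≡.cong (mod ∘ e)
      by-cases : Dec (x ≡ zeroV) → Dec (∃ λ γ → ∃ λ i → used γ i ≡ true × x ∈S U γ i) →
                 ζ^ k (e (h x)) ≋ expansion x
      by-cases (yes x≡0) _ = ≋-trans (ζ^χ-cong (≡.trans (≡.cong h x≡0) h-zeroV))
        (≋-sym (≡.subst (λ y → expansion y ≋ ζ^ k (e γ₀)) (≡.sym x≡0) expansion-zeroV))
      by-cases (no x≢0) (yes (γ , i , u , x∈U)) =
        ≋-trans (ζ^χ-cong (h-inside γ i x u x≢0 x∈U)) (≋-sym (expansion-inside x≢0 u x∈U))
      by-cases (no x≢0) (no ∄) =
        ≋-trans (ζ^χ-cong (h-outside x x≢0 ∉)) (≋-trans ζ^χ𝟘≋one (≋-sym (expansion-outside x≢0 ∉)))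
        where
        ∉ : ∀ γ i → used γ i ≡ true → ¬ x ∈S U γ i
        ∉ γ i u x∈U = ∄ (γ , i , u , x∈U)

    scale-expansion : ∀ z x → scale z (expansion x) ≋
      (scale z one ⊞ (∑∑ (λ γ i → scale (z ℤ.* coefficient x γ i) (ε γ)) ⊞ scale (z ℤ.* [ x ≡0]) (ε γ₀)))
    scale-expansion z x = ≋-trans (scale-distribˡ z one _) (⊞-cong (≋-refl {scale z one})
      (≋-trans (scale-distribˡ z _ _) (⊞-cong (scale-∑∑-scale z (coefficient x) ε) (scale-assoc z [ x ≡0] (ε γ₀)))))

    W : C
    W = ∑∑ (λ γ i → scale (weight γ i) (ε γ))

    module _ (b : V n) where
      s : V n → ℤ
      s x = sign (b · x)

      ∑s : ℤ
      ∑s = if orthogonal b (standardBasis n) then + (2 ^ n) else + 0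

      T : Fin N → Fin q → ℤ
      T γ i = if orthogonal b (Subspace.basis (U γ i)) then M else + 0

      ∑-s : ℤΣ.∑V n s ≡ ∑s
      ∑-s = ≡.trans (ℤΣ.∑V-cong n (λ x → ≡.cong (sign ∘ (b ·_)) (≡.sym (comb-standardBasis n x))))
                    (∑-sign-span b (standardBasis n))

      ∑-s[∈] : ∀ γ i → ℤΣ.∑V n (λ x → s x ℤ.* [ x ∈ U γ i ]) ≡ T γ i
      ∑-s[∈] γ i = begin
        ℤΣ.∑V n (λ x → s x ℤ.* [ x ∈ U γ i ])
          ≡⟨ ℤΣ.∑V-cong n (λ x → ℤ-multiply.∑V-hom (s x) m _) ⟩
        ℤΣ.∑V n (λ x → ℤΣ.∑V m (λ c → s x ℤ.* indicator (comb bs c) x))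
          ≡⟨ ℤΣ.∑V-comm n m _ ⟩
        ℤΣ.∑V m (λ c → ℤΣ.∑V n (λ x → s x ℤ.* indicator (comb bs c) x))
          ≡⟨ ℤΣ.∑V-cong m (∑V-*-indicator s ∘ comb bs) ⟩
        ℤΣ.∑V m (λ c → s (comb bs c))
          ≡⟨ ∑-sign-span b bs ⟩
        T γ i ∎
        where
        open ≡.≡-Reasoning
        bs = Subspace.basis (U γ i)

      ∑-s-coefficient : ∀ γ i → ℤΣ.∑V n (λ x → s x ℤ.* coefficient x γ i) ≡ weight γ i ℤ.* (T γ i ℤ.- + 1)
      ∑-s-coefficient γ i = begin
        ℤΣ.∑V n (λ x → s x ℤ.* coefficient x γ i)
          ≡⟨ ℤΣ.∑V-cong n (λ x → rearrange (s x) w [ x ∈ U γ i ] [ x ≡0]) ⟩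
        ℤΣ.∑V n (λ x → w ℤ.* (s x ℤ.* [ x ∈ U γ i ] ℤ.+ ℤ.- (s x ℤ.* [ x ≡0])))
          ≡⟨ ≡.sym (ℤ-multiply.∑V-hom w n _) ⟩
        w ℤ.* ℤΣ.∑V n (λ x → s x ℤ.* [ x ∈ U γ i ] ℤ.+ ℤ.- (s x ℤ.* [ x ≡0]))
          ≡⟨ ≡.cong (w ℤ.*_) (ℤΣ.∑V-distrib n _ _) ⟩
        w ℤ.* (ℤΣ.∑V n (λ x → s x ℤ.* [ x ∈ U γ i ]) ℤ.+ ℤΣ.∑V n (λ x → ℤ.- (s x ℤ.* [ x ≡0])))
          ≡⟨ ≡.cong₂ (λ a t → w ℤ.* (a ℤ.+ t)) (∑-s[∈] γ i) (≡.sym (ℤ-negate.∑V-hom n _)) ⟩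
        w ℤ.* (T γ i ℤ.+ ℤ.- ℤΣ.∑V n (λ x → s x ℤ.* [ x ≡0]))
          ≡⟨ ≡.cong (λ t → w ℤ.* (T γ i ℤ.- t)) (≡.trans (∑V-*-indicator s zeroV) (≡.cong sign (·-zeroʳ b))) ⟩
        w ℤ.* (T γ i ℤ.- + 1) ∎
        where
        open ≡.≡-Reasoning
        w = weight γ i
        rearrange : ∀ s w a d → s ℤ.* (w ℤ.* (a ℤ.- d)) ≡ w ℤ.* (s ℤ.* a ℤ.+ ℤ.- (s ℤ.* d))
        rearrange = solve-∀

      walshSum≋ : walshSum {k} {m} B ip h χ b ≋
        (scale ∑s one ⊞ (∑∑ (λ γ i → scale (weight γ i ℤ.* (T γ i ℤ.- + 1)) (ε γ)) ⊞ ε γ₀))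
      walshSum≋ = begin
        walshSum {k} {m} B ip h χ b
          ≈⟨ sumV≋∑V n _ ⟩
        CΣ.∑V n (λ x → ζ^ k (e (h x) ℕ.+ bitExp k (b · x)))
          ≈⟨ CΣ.∑V-cong n (λ x → ≋-trans (ζ^-+bitExp (e (h x)) (b · x)) (scale-congʳ (s x) (ζ^χh≋expansion x))) ⟩
        CΣ.∑V n (λ x → scale (s x) (expansion x))
          ≈⟨ CΣ.∑V-cong n (λ x → scale-expansion (s x) x) ⟩
        CΣ.∑V n (λ x → scale (s x) one ⊞ (spread-part x ⊞ zero-part x))
          ≈⟨ ≋-trans (CΣ.∑V-distrib n (λ x → scale (s x) one) (λ x → spread-part x ⊞ zero-part x))
                     (⊞-cong (≋-refl {CΣ.∑V n (λ x → scale (s x) one)}) (CΣ.∑V-distrib n spread-part zero-part)) ⟩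
        CΣ.∑V n (λ x → scale (s x) one) ⊞ (CΣ.∑V n spread-part ⊞ CΣ.∑V n zero-part)
          ≈⟨ ⊞-cong (∑V-scale n s one) (⊞-cong (∑V-∑∑-scale n (λ x γ i → s x ℤ.* coefficient x γ i) ε)
                                            (∑V-scale n (λ x → s x ℤ.* [ x ≡0]) (ε γ₀))) ⟩
        scale (ℤΣ.∑V n s) one ⊞ (∑∑ (λ γ i → scale (ℤΣ.∑V n (λ x → s x ℤ.* coefficient x γ i)) (ε γ))
                                ⊞ scale (ℤΣ.∑V n (λ x → s x ℤ.* [ x ≡0])) (ε γ₀))
          ≈⟨ ⊞-cong (scale-congˡ ∑-s one)
                    (⊞-cong (∑∑-cong (λ γ i → scale-congˡ (∑-s-coefficient γ i) (ε γ)))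
                            (≋-trans (scale-congˡ ∑-s[≡0] (ε γ₀)) (scale-identityˡ (ε γ₀)))) ⟩
        scale ∑s one ⊞ (∑∑ (λ γ i → scale (weight γ i ℤ.* (T γ i ℤ.- + 1)) (ε γ)) ⊞ ε γ₀) ∎
        where
        open ≋-Reasoning
        spread-part zero-part : V n → C
        spread-part x = ∑∑ (λ γ i → scale (s x ℤ.* coefficient x γ i) (ε γ))
        zero-part x = scale (s x ℤ.* [ x ≡0]) (ε γ₀)
        ∑-s[≡0] : ℤΣ.∑V n (λ x → s x ℤ.* [ x ≡0]) ≡ + 1
        ∑-s[≡0] = ≡.trans (∑V-*-indicator s zeroV) (≡.cong sign (·-zeroʳ b))

      Y : C
      Y = ∑∑ (λ γ i → scale (weight γ i ℤ.* T γ i) (ε γ))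

      ∑∑[T-1]≋Y-W : ∑∑ (λ γ i → scale (weight γ i ℤ.* (T γ i ℤ.- + 1)) (ε γ)) ≋ (Y ⊞ scale -1ℤ W)
      ∑∑[T-1]≋Y-W = ≋-trans (∑∑-cong (λ γ i j → split (weight γ i) (T γ i) (coeff (ε γ) j)))
        (≋-trans (CΣ.∑∑-distrib (λ γ i → scale (weight γ i ℤ.* T γ i) (ε γ))
                                (λ γ i → scale (-1ℤ ℤ.* weight γ i) (ε γ)))
                 (⊞-cong (≋-refl {Y}) (≋-sym (scale-∑∑-scale -1ℤ weight ε))))
        where
        split : ∀ w t c → w ℤ.* (t ℤ.- + 1) ℤ.* c ≡ w ℤ.* t ℤ.* c ℤ.+ -1ℤ ℤ.* w ℤ.* c
        split = solve-∀

      weight*T≡0 : ∀ γ i → ¬ (used γ i ≡ true × orthogonal b (Subspace.basis (U γ i)) ≡ true) →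
                   weight γ i ℤ.* T γ i ≡ + 0
      weight*T≡0 γ i ¬both with used γ i | orthogonal b (Subspace.basis (U γ i))
      ... | false | _     = ≡.refl
      ... | true  | false = ≡.refl
      ... | true  | true  = ⊥-elim (¬both (≡.refl , ≡.refl))

      Y≋-if-b≡0 : W ≋ (scale (ℤ.- M) one ⊞ ε γ₀) → orthogonal b (standardBasis n) ≡ true →
                  Y ≋ (scale (ℤ.- ∑s) one ⊞ scale M (ε γ₀))
      Y≋-if-b≡0 W≋ b⊥all j = ≡.trans (Y≋MW j) (≡.trans (scale-congʳ M W≋ j)
        (≡.trans (expand M (coeff one j) (coeff (ε γ₀) j))
                 (≡.cong (λ S → ℤ.- S ℤ.* coeff one j ℤ.+ M ℤ.* coeff (ε γ₀) j) (≡.sym ∑s≡M*M))))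
        where
        T≡M : ∀ γ i → T γ i ≡ M
        T≡M γ i rewrite orthogonal-standardBasis⇒zeroV b b⊥all | orthogonal-zeroV (Subspace.basis (U γ i)) = ≡.refl
        Y≋MW : Y ≋ scale M W
        Y≋MW = ≋-trans
          (∑∑-cong (λ γ i → scale-congˡ (≡.trans (≡.cong (weight γ i ℤ.*_) (T≡M γ i)) (ℤₚ.*-comm _ M))
                                        (ε γ)))
          (≋-sym (scale-∑∑-scale M weight ε))
        ∑s≡M*M : ∑s ≡ M ℤ.* M
        ∑s≡M*M = ≡.trans (≡.cong (λ t → if t then + (2 ^ n) else + 0) b⊥all) 2^n≡M*M
        expand : ∀ M o g → M ℤ.* (ℤ.- M ℤ.* o ℤ.+ g) ≡ ℤ.- (M ℤ.* M) ℤ.* o ℤ.+ M ℤ.* g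
        expand = solve-∀

      -- A b ≠ 0 is orthogonal to at most one member of the spread.
      Y≋-if-b≢0 : orthogonal b (standardBasis n) ≡ false →
        Dec (∃ λ γ → ∃ λ i → used γ i ≡ true × orthogonal b (Subspace.basis (U γ i)) ≡ true) →
        ∃ λ γ → Y ≋ (scale (ℤ.- ∑s) one ⊞ scale M (ε γ))
      Y≋-if-b≢0 b⊥̸all (yes (γ , i , u , b⊥U)) =
        γ , ≋-trans Y≋Mε (≋-sym (≋-trans (⊞-cong ∑s-part (≋-refl {scale M (ε γ)}))
                                         (⊞-identityˡ (scale M (ε γ)))))
        where
        ∑s-part : scale (ℤ.- ∑s) one ≋ 0C
        ∑s-part = scale-congˡ (≡.cong (λ t → ℤ.- (if t then + (2 ^ n) else + 0)) b⊥̸all) one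
        b≢0 : b ≢ zeroV
        b≢0 ≡.refl with ≡.trans (≡.sym (orthogonal-zeroV (standardBasis n))) b⊥̸all
        ... | ()
        single : ∀ γ′ i′ → (γ′ , i′) ≢ (γ , i) →
                 ¬ (used γ′ i′ ≡ true × orthogonal b (Subspace.basis (U γ′ i′)) ≡ true)
        single γ′ i′ ne (u′ , b⊥U′) =
          b≢0 (trivInt-orthogonal⇒zeroV (U γ′ i′) (U γ i) (spread γ′ i′ γ i u′ u ne) b b⊥U′ b⊥U)
        weight*T≡M : weight γ i ℤ.* T γ i ≡ M
        weight*T≡M rewrite u | b⊥U = ℤₚ.*-identityˡ M
        Y≋Mε : Y ≋ scale M (ε γ)
        Y≋Mε = ≋-trans
          (CΣ.∑∑-single γ i (λ γ′ i′ ne → scale-congˡ (weight*T≡0 γ′ i′ (single γ′ i′ ne)) (ε γ′)))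
          (scale-congˡ weight*T≡M (ε γ))
      Y≋-if-b≢0 b⊥̸all (no ∄) =
        𝟘 , ≋-trans Y≋0 (≋-sym (≋-trans (⊞-cong ∑s-part (scale-ε𝟘 M)) (⊞-identityˡ 0C)))
        where
        ∑s-part : scale (ℤ.- ∑s) one ≋ 0C
        ∑s-part = scale-congˡ (≡.cong (λ t → ℤ.- (if t then + (2 ^ n) else + 0)) b⊥̸all) one
        Y≋0 : Y ≋ 0C
        Y≋0 = CΣ.∑∑-zero (λ γ i → scale-congˡ (weight*T≡0 γ i (λ both → ∄ (γ , i , both))) (ε γ))

      Y≋ : W ≋ (scale (ℤ.- M) one ⊞ ε γ₀) → ∃ λ γ → Y ≋ (scale (ℤ.- ∑s) one ⊞ scale M (ε γ))
      Y≋ W≋ = by-cases (orthogonal b (standardBasis n)) ≡.refl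
        where
        by-cases : ∀ t → orthogonal b (standardBasis n) ≡ t → ∃ λ γ → Y ≋ (scale (ℤ.- ∑s) one ⊞ scale M (ε γ))
        by-cases true  b⊥all  = γ₀ , Y≋-if-b≡0 W≋ b⊥all
        by-cases false b⊥̸all = Y≋-if-b≢0 b⊥̸all (Finₚ.any? (λ γ → Finₚ.any? (λ i →
          (used γ i 𝔹.≟ true) ×-dec (orthogonal b (Subspace.basis (U γ i)) 𝔹.≟ true))))

      walshSum-unit-multiple : W ≋ (scale (ℤ.- M) one ⊞ ε γ₀) →
                               ∃ λ E → walshSum {k} {m} B ip h χ b ≋ scale M (ζ^ k E)
      walshSum-unit-multiple W≋ =
        e γ , ≋-trans walshSum≋ (λ j → ≡.trans (coefficients j) (≡.cong (M ℤ.*_) (one⊞ε γ j)))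
        where
        γ = proj₁ (Y≋ W≋)
        coefficients : ∀ j →
          coeff (scale ∑s one ⊞ (∑∑ (λ γ i → scale (weight γ i ℤ.* (T γ i ℤ.- + 1)) (ε γ)) ⊞ ε γ₀)) j
            ≡ M ℤ.* (coeff one j ℤ.+ coeff (ε γ) j)
        coefficients j = ≡.trans
          (≡.cong (λ t → ∑s ℤ.* coeff one j ℤ.+ (t ℤ.+ coeff (ε γ₀) j))
                  (≡.trans (∑∑[T-1]≋Y-W j) (≡.cong₂ (λ y w → y ℤ.+ -1ℤ ℤ.* w) (proj₂ (Y≋ W≋) j) (W≋ j))))
          (collect ∑s (coeff one j) M (coeff (ε γ) j) (coeff (ε γ₀) j))
          where
          collect : ∀ S o M g g₀ → S ℤ.* o ℤ.+ ((ℤ.- S ℤ.* o ℤ.+ M ℤ.* g) ℤ.+ -1ℤ ℤ.* (ℤ.- M ℤ.* o ℤ.+ g₀) ℤ.+ g₀)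
                                   ≡ M ℤ.* (o ℤ.+ g)
          collect = solve-∀

    W≋-from-counts : ∀ p → p ℕ.* N ≡ 2 ^ m → Balanced p → W ≋ (scale (ℤ.- M) one ⊞ ε γ₀)
    W≋-from-counts p pN≡2^m counts = begin
      W                                               ≈⟨ CΣ.sum-cong-≋ (λ γ → ≋-sym (ScaleOf.∑-hom (ε γ) q _)) ⟩
      CΣ.sum (λ γ → scale (ℤΣ.sum (weight γ)) (ε γ))  ≈⟨ CΣ.sum-cong-≋ per-γ ⟩
      CΣ.sum (λ γ → pε γ ⊞ δε γ)                      ≈⟨ CΣ.∑-distrib-+ pε δε ⟩
      CΣ.sum pε ⊞ CΣ.sum δε
        ≈⟨ ⊞-cong (≋-sym (Scale.∑-hom (+ p) N ε)) (CΣ.∑-single γ₀ δε≋0) ⟩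
      scale (+ p) (CΣ.sum ε) ⊞ δε γ₀                  ≈⟨ ⊞-cong (scale-congʳ (+ p) ∑ε) δε≋ε ⟩
      scale (+ p) (scale (ℤ.- + N) one) ⊞ ε γ₀        ≈⟨ ⊞-cong p·-N (≋-refl {ε γ₀}) ⟩
      scale (ℤ.- M) one ⊞ ε γ₀                        ∎
      where
      open ≋-Reasoning
      pε δε : Fin N → C
      pε γ = scale (+ p) (ε γ)
      δε γ = scale [ γ ≡γ₀] (ε γ)
      per-γ : ∀ γ → scale (ℤΣ.sum (weight γ)) (ε γ) ≋ (pε γ ⊞ δε γ)
      per-γ γ with γ Fin.≟ 𝟘
      ... | yes ≡.refl = ≋-trans (scale-ε𝟘 (ℤΣ.sum (weight 𝟘)))
                                 (≋-sym (≋-trans (⊞-cong (scale-ε𝟘 (+ p)) (scale-ε𝟘 [ 𝟘 ≡γ₀])) (⊞-identityˡ 0C)))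
      ... | no  γ≢𝟘    = ≋-trans (scale-congˡ (counts γ γ≢𝟘) (ε γ)) (scale-distribʳ (+ p) [ γ ≡γ₀] (ε γ))
      δε≋0 : ∀ γ → γ ≢ γ₀ → δε γ ≋ 0C
      δε≋0 γ γ≢γ₀ = scale-congˡ (≡.cong (λ b → if b then + 1 else + 0) (dec-false (γ Fin.≟ γ₀) γ≢γ₀)) (ε γ)
      δε≋ε : δε γ₀ ≋ ε γ₀
      δε≋ε = ≋-trans (scale-congˡ (≡.cong (λ b → if b then + 1 else + 0) (dec-true (γ₀ Fin.≟ γ₀) ≡.refl)) (ε γ₀))
                     (scale-identityˡ (ε γ₀))
      p·-N : scale (+ p) (scale (ℤ.- + N) one) ≋ scale (ℤ.- M) one
      p·-N = ≋-trans (scale-assoc (+ p) (ℤ.- + N) one) (scale-congˡ (≡.trans (≡.sym (ℤₚ.neg-distribʳ-* (+ p) (+ N)))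
               (≡.cong ℤ.-_ (≡.trans (≡.sym (ℤₚ.pos-* p N)) (≡.cong +_ pN≡2^m)))) one)

    spread-function-bent : ∀ p → p ℕ.* N ≡ 2 ^ m → Balanced p →
      ∀ b → let S = walshSum {k} {m} B ip h χ b in (S ⊠ conj S) ≋ constC (+ (2 ^ (2 * m)))
    spread-function-bent p pN≡2^m counts b =
      ≋-trans (unit-multiple-norm M (proj₁ unit-multiple) (proj₂ unit-multiple))
              (scale-congˡ (≡.sym 2^n≡M*M) (ζ^ k 0))
      where unit-multiple = walshSum-unit-multiple b (W≋-from-counts p pN≡2^m counts)

-- The two constructions

module SpreadConstructions (m k′ : ℕ) (B : AbGroupOfOrder2^ (suc k′)) where
  open AbGroupOfOrder2^ B using (𝟘)

  k = suc k′
  p = 2 ^ (m ∸ k)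
  n = 2 * m

  module PartI (U : Fin (2 ^ k) → Fin p → Subspace n m)
    (disjoint : ∀ γ γ′ i j → γ ≢ 𝟘 → γ′ ≢ 𝟘 → (γ , i) ≢ (γ′ , j) → TrivInt (U γ i) (U γ′ j))
    (f : V n → Fin (2 ^ k))
    (f-inside : ∀ γ → γ ≢ 𝟘 → ∀ x → (f x ≡ γ → x ≢ zeroV × ∃ λ i → x ∈S U γ i)
                                   × (x ≢ zeroV × (∃ λ i → x ∈S U γ i) → f x ≡ γ))
    (f-outside : ∀ x → (∀ γ i → γ ≢ 𝟘 → x ∈S U γ i → x ≡ zeroV) → f x ≡ 𝟘) where

    nonzero : Fin (2 ^ k) → Fin p → Bool
    nonzero γ _ = does (¬? (γ Fin.≟ 𝟘))

    nonzero⇒≢𝟘 : ∀ {γ} → does (¬? (γ Fin.≟ 𝟘)) ≡ true → γ ≢ 𝟘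
    nonzero⇒≢𝟘 {γ} = does≡true⇒ (¬? (γ Fin.≟ 𝟘))

    spreadFunction : SpreadFunction m B f
    spreadFunction = record
      { q         = p
      ; U         = U
      ; used      = nonzero
      ; spread    = λ γ i γ′ j u u′ → disjoint γ γ′ i j (nonzero⇒≢𝟘 u) (nonzero⇒≢𝟘 u′)
      ; γ₀        = 𝟘
      ; h-zeroV   = f-outside zeroV (λ _ _ _ _ → ≡.refl)
      ; h-inside  = λ γ i x u x≢0 x∈U → proj₂ (f-inside γ (nonzero⇒≢𝟘 u) x) (x≢0 , i , x∈U)
      ; h-outside = λ x x≢0 ∉ → f-outside x (λ γ i γ≢𝟘 → ⊥-elim ∘ ∉ γ i (dec-true (¬? (γ Fin.≟ 𝟘)) γ≢𝟘))
      }

    counts : SpreadFunction.Balanced spreadFunction p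
    counts γ γ≢𝟘 rewrite dec-false (γ Fin.≟ 𝟘) γ≢𝟘 =
      ≡.trans (∑-const p (+ 1)) (≡.trans (ℤₚ.*-identityʳ (+ p)) (≡.sym (ℤₚ.+-identityʳ (+ p))))

  module PartII (γ̃ : Fin (2 ^ k)) (γ̃≢𝟘 : γ̃ ≢ 𝟘) (U : Fin (2 ^ k) → Fin (suc p) → Subspace n m)
    (disjoint : ∀ γ γ′ i j → γ ≢ 𝟘 × (γ ≡ γ̃ ⊎ toℕ i < p) → γ′ ≢ 𝟘 × (γ′ ≡ γ̃ ⊎ toℕ j < p) →
                (γ , i) ≢ (γ′ , j) → TrivInt (U γ i) (U γ′ j))
    (g : V n → Fin (2 ^ k))
    (g-γ̃ : ∀ x → (g x ≡ γ̃ → ∃ λ i → x ∈S U γ̃ i) × ((∃ λ i → x ∈S U γ̃ i) → g x ≡ γ̃))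
    (g-inside : ∀ γ → γ ≢ 𝟘 → γ ≢ γ̃ → ∀ x →
                (g x ≡ γ → x ≢ zeroV × ∃ λ i → toℕ i < p × x ∈S U γ i)
                × (x ≢ zeroV × (∃ λ i → toℕ i < p × x ∈S U γ i) → g x ≡ γ))
    (g-outside : ∀ x → (∀ γ i → γ ≢ 𝟘 × (γ ≡ γ̃ ⊎ toℕ i < p) → ¬ (x ∈S U γ i)) → g x ≡ 𝟘) where

    Used? : ∀ γ (i : Fin (suc p)) → Dec (γ ≢ 𝟘 × (γ ≡ γ̃ ⊎ toℕ i < p))
    Used? γ i = ¬? (γ Fin.≟ 𝟘) ×-dec ((γ Fin.≟ γ̃) ⊎-dec (toℕ i ℕ.<? p))

    used : Fin (2 ^ k) → Fin (suc p) → Bool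
    used γ i = does (Used? γ i)

    used⇒Used : ∀ {γ i} → used γ i ≡ true → γ ≢ 𝟘 × (γ ≡ γ̃ ⊎ toℕ i < p)
    used⇒Used {γ} {i} = does≡true⇒ (Used? γ i)

    g-inside′ : ∀ γ i x → used γ i ≡ true → x ≢ zeroV → x ∈S U γ i → g x ≡ γ
    g-inside′ γ i x u x≢0 x∈U with used⇒Used u | γ Fin.≟ γ̃
    ... | _         , _       | yes ≡.refl = proj₂ (g-γ̃ x) (i , x∈U)
    ... | _         , inj₁ γ≡γ̃ | no γ≢γ̃   = ⊥-elim (γ≢γ̃ γ≡γ̃)
    ... | γ≢𝟘       , inj₂ i<p | no γ≢γ̃   = proj₂ (g-inside γ γ≢𝟘 γ≢γ̃ x) (x≢0 , i , i<p , x∈U)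

    spreadFunction : SpreadFunction m B g
    spreadFunction = record
      { q         = suc p
      ; U         = U
      ; used      = used
      ; spread    = λ γ i γ′ j u u′ → disjoint γ γ′ i j (used⇒Used u) (used⇒Used u′)
      ; γ₀        = γ̃
      ; h-zeroV   = proj₂ (g-γ̃ zeroV) (fzero , zeroV , comb-zeroV (Subspace.basis (U γ̃ fzero)))
      ; h-inside  = g-inside′
      ; h-outside = λ x x≢0 ∉ → g-outside x (λ γ i Uγi → ∉ γ i (dec-true (Used? γ i) Uγi))
      }

    counts : SpreadFunction.Balanced spreadFunction p
    counts γ γ≢𝟘 with γ Fin.≟ γ̃
    ... | yes ≡.refl rewrite dec-false (γ̃ Fin.≟ 𝟘) γ̃≢𝟘 =
      ≡.trans (∑-const (suc p) (+ 1)) (≡.trans (ℤₚ.*-identityʳ (+ suc p)) (≡.cong +_ (ℕₚ.+-comm 1 p)))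
    ... | no  γ≢γ̃ rewrite dec-false (γ Fin.≟ 𝟘) γ≢𝟘 =
      ≡.trans (∑-[<] p) (≡.sym (ℤₚ.+-identityʳ (+ p)))

  p*2^k≡2^m : k ≤ m → p ℕ.* 2 ^ k ≡ 2 ^ m
  p*2^k≡2^m k≤m = ≡.trans (≡.sym (ℕₚ.^-distribˡ-+-* 2 (m ∸ k) k)) (≡.cong (2 ^_) (ℕₚ.m∸n+n≡m k≤m))

mainTheorem1 :
  ∀ (m k : ℕ) → 1 ≤ m → 1 ≤ k → k ≤ m →
  (ip : InnerProduct (2 * m)) →
  (B : AbGroupOfOrder2^ k) →
  let open AbGroupOfOrder2^ B in
  -- (I)
  (∀ (U : Fin (2 ^ k) → Fin (2 ^ (m ∸ k)) → Subspace (2 * m) m) →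
    (∀ γ γ′ i j → γ ≢ 𝟘 → γ′ ≢ 𝟘 → (γ , i) ≢ (γ′ , j) → TrivInt (U γ i) (U γ′ j)) →
    ∀ (f : V (2 * m) → Fin (2 ^ k)) →
    (∀ γ → γ ≢ 𝟘 → ∀ x →
      (f x ≡ γ → x ≢ zeroV × ∃ λ i → x ∈S U γ i)
      × (x ≢ zeroV × (∃ λ i → x ∈S U γ i) → f x ≡ γ)) →
    (∀ x → (∀ γ i → γ ≢ 𝟘 → x ∈S U γ i → x ≡ zeroV) → f x ≡ 𝟘) →
    IsBent {k} {m} B ip f)
  ×
  -- (II)
  (∀ (γ̃ : Fin (2 ^ k)) → γ̃ ≢ 𝟘 →
    ∀ (U : Fin (2 ^ k) → Fin (suc (2 ^ (m ∸ k))) → Subspace (2 * m) m) →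
    let Used : Fin (2 ^ k) → Fin (suc (2 ^ (m ∸ k))) → Set
        Used γ i = γ ≢ 𝟘 × (γ ≡ γ̃ ⊎ toℕ i < 2 ^ (m ∸ k))
    in
    (∀ γ γ′ i j → Used γ i → Used γ′ j → (γ , i) ≢ (γ′ , j) → TrivInt (U γ i) (U γ′ j)) →
    ∀ (g : V (2 * m) → Fin (2 ^ k)) →
    (∀ x →
      (g x ≡ γ̃ → ∃ λ i → x ∈S U γ̃ i)
      × ((∃ λ i → x ∈S U γ̃ i) → g x ≡ γ̃)) →
    (∀ γ → γ ≢ 𝟘 → γ ≢ γ̃ → ∀ x →
      (g x ≡ γ → x ≢ zeroV × ∃ λ i → toℕ i < 2 ^ (m ∸ k) × x ∈S U γ i)
      × (x ≢ zeroV × (∃ λ i → toℕ i < 2 ^ (m ∸ k) × x ∈S U γ i) → g x ≡ γ)) →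
    (∀ x → (∀ γ i → Used γ i → ¬ (x ∈S U γ i)) → g x ≡ 𝟘) →
    IsBent {k} {m} B ip g)
mainTheorem1 m zero     _ () _ ip B
mainTheorem1 m (suc k′) _ _ k≤m ip B =
    (λ U disjoint f f-inside f-outside χ χ-nontrivial →
       let open PartI U disjoint f f-inside f-outside
       in spread-function-bent χ χ-nontrivial spreadFunction p (p*2^k≡2^m k≤m) counts)
  , (λ γ̃ γ̃≢𝟘 U disjoint g g-γ̃ g-inside g-outside χ χ-nontrivial →
       let open PartII γ̃ γ̃≢𝟘 U disjoint g g-γ̃ g-inside g-outside
       in spread-function-bent χ χ-nontrivial spreadFunction p (p*2^k≡2^m k≤m) counts)
  where
  open SpreadConstructions m k′ B
  open SpreadWalshSpectrum m k′ ip B using (spread-function-bent)
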